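{- For $n\ge1$ let $a_n$ be the number of $n\times n$ permutation matrices containing no mutable cell (equivalently, the number of placements of $n$ mutually non-attacking kings on an $n\times n$ chessboard with one king in each row and each column). Then \[a_n=(-1)^n\sum_{m=1}^n m!\,(-2)^m\sum_{\pi\in\mathcal{C}_{n,m}}\frac{1}{2^{\pi_1}}=(-1)^n\sum_{\pi\in\mathcal{C}_n}\frac{\ell(\pi)!\,(-2)^{\ell(\pi)}}{2^{\pi_1}}.\]
   Context: A cell of a $0$-$1$ matrix is mutable if it contains $0$ and at least two of its orthogonal neighbours (north, south, east, west) contain $1$. $\mathcal{C}_n$ is the set of compositions of $n$ (ordered tuples of positive integers summing to $n$) and $\mathcal{C}_{n,m}$ the set of those with exactly $m$ parts. For a composition $\pi$, $\ell(\pi)$ is its number of parts and $\pi_1$ denotes the number of parts of $\pi$ equal to $1$ (not the first part). -}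

module Defs where

open import Data.Bool using (Bool; true; false; not; _∧_; if_then_else_)
open import Data.Nat as ℕ using (ℕ; zero; suc; _≡ᵇ_; _<ᵇ_; _<?_)
open import Data.Nat.ListAction using (sum)
open import Data.Fin using (Fin; toℕ; fromℕ<)
open import Data.Vec as Vec using (Vec; []; _∷_; lookup)
open import Data.List as List using (List; []; _∷_; map; concatMap; upTo; length; filterᵇ; foldr; applyUpTo)
open import Data.Bool.ListAction using (and)
open import Data.Integer using (+_)
open import Data.Rational as ℚ using (ℚ; 0ℚ; 1ℚ; ½)
open import Relation.Nullary using (yes; no)

-- An n×n permutation matrix is encoded by a vector σ : Vec (Fin n) n with
-- pairwise distinct entries: row i has its unique 1 in column σ i
-- (rows/columns indexed 0..n-1).

allVecs : (n k : ℕ) → List (Vec (Fin n) k)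
allVecs n zero    = [] ∷ []
allVecs n (suc k) = concatMap (λ x → map (x ∷_) (allVecs n k)) (List.allFin n)

allᵇ : {A : Set} → (A → Bool) → List A → Bool
allᵇ p xs = and (map p xs)

distinctᵇ : List ℕ → Bool
distinctᵇ []       = true
distinctᵇ (x ∷ xs) = allᵇ (λ y → not (x ≡ᵇ y)) xs ∧ distinctᵇ xs

isPermᵇ : ∀ {n} → Vec (Fin n) n → Bool
isPermᵇ v = distinctᵇ (List.map toℕ (Vec.toList v))

-- entry (i , j) of the 0-1 matrix of σ; cells outside the n×n board read 0
-- (they do not exist, so they never count as a neighbour containing 1)
entry : ∀ {n} → Vec (Fin n) n → ℕ → ℕ → Bool
entry {n} v i j with i <? n
... | yes p = toℕ (lookup v (fromℕ< p)) ≡ᵇ j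
... | no _  = false

b2n : Bool → ℕ
b2n true  = 1
b2n false = 0

onesAround : ∀ {n} → Vec (Fin n) n → ℕ → ℕ → ℕ
onesAround v i j =
  north i ℕ.+ b2n (entry v (suc i) j) ℕ.+ west j ℕ.+ b2n (entry v i (suc j))
  where
  north : ℕ → ℕ
  north zero    = 0
  north (suc a) = b2n (entry v a j)
  west : ℕ → ℕ
  west zero    = 0
  west (suc b) = b2n (entry v i b)

mutableᵇ : ∀ {n} → Vec (Fin n) n → ℕ → ℕ → Bool
mutableᵇ v i j = not (entry v i j) ∧ (1 <ᵇ onesAround v i j)

noMutableᵇ : ∀ {n} → Vec (Fin n) n → Bool
noMutableᵇ {n} v = allᵇ (λ i → allᵇ (λ j → not (mutableᵇ v i j)) (upTo n)) (upTo n)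

a : ℕ → ℕ
a n = length (filterᵇ (λ v → isPermᵇ v ∧ noMutableᵇ v) (allVecs n n))

listsLen : (n k : ℕ) → List (List ℕ)
listsLen n zero    = [] ∷ []
listsLen n (suc k) = concatMap (λ x → map (suc x ∷_) (listsLen n k)) (upTo n)

-- C n m : compositions of n with exactly m parts (each part is ≤ n)
C : ℕ → ℕ → List (List ℕ)
C n m = filterᵇ (λ π → sum π ≡ᵇ n) (listsLen n m)

-- Cₙ : all compositions of n (a composition of n has at most n parts)
Cₙ : ℕ → List (List ℕ)
Cₙ n = concatMap (C n) (upTo (suc n))

ones : List ℕ → ℕ
ones π = length (filterᵇ (λ x → x ≡ᵇ 1) π)

infixr 8 _^ℚ_
_^ℚ_ : ℚ → ℕ → ℚ
q ^ℚ zero  = 1ℚ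
q ^ℚ suc k = q ℚ.* (q ^ℚ k)

Σℚ : {A : Set} → List A → (A → ℚ) → ℚ
Σℚ xs f = foldr (λ x s → f x ℚ.+ s) 0ℚ xs

fromℕ : ℕ → ℚ
fromℕ k = (+ k) ℚ./ 1

inv2^ : ℕ → ℚ
inv2^ k = ½ ^ℚ k

oneTo : ℕ → List ℕ
oneTo n = applyUpTo suc n

{-# OPTIONS --safe #-}
-- A zero cell is mutable exactly when it has a 1 directly above or below it and a 1 directly to
-- its left or right, that is, when two consecutive rows have their 1s in adjacent columns.  So a n
-- counts the permutations w of {0, …, n-1} with w(i+1) ≠ w(i) ± 1 for all i.  Expanding the
-- indicator ∏ᵢ (1 - [w(i+1) = w(i) ± 1]) cuts the rows into consecutive blocks, described by a
-- composition π of n with sign (-1)^(n - ℓ(π)), inside each of which w moves by ±1 at every step.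
-- For a permutation such a block is an interval of values traversed upwards or downwards (two ways
-- if it has at least two cells, one way otherwise), and the ℓ(π) intervals tile {0, …, n-1} in any
-- of ℓ(π)! orders, which gives the weight ℓ(π)! 2^(ℓ(π) - π₁).  The tiling count is the case L = n
-- of the count [L ≤ n] m! C(n - L + m, m) of ordered placements of m disjoint intervals of total
-- length L in {0, …, n-1}, proved by induction on n according to whether the last cell is empty or
-- ends one of the intervals.

module Submission where

open import Algebra.Bundles using (CommutativeSemiring)
open import Level using (0ℓ)
open import Relation.Binary.PropositionalEquality using (_≡_)

-- Used at ℕ and ℚ, whose semiring equality is _≡_; ≈⇒≡ lets all lemmas be stated with _≡_.
module ListSum (R : CommutativeSemiring 0ℓ 0ℓ)
  (≈⇒≡ : ∀ {x y} → CommutativeSemiring._≈_ R x y → x ≡ y) where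

  open import Data.Bool using (Bool; true; false; _∧_)
  open import Data.Fin using (Fin; zero; suc)
  open import Data.List using (List; []; _∷_; _++_; map; concatMap; foldr; filterᵇ; upTo; allFin)
  open import Data.List.Membership.Propositional using (_∈_)
  open import Data.List.Membership.Propositional.Properties using (∈-upTo⁻)
  open import Data.List.Properties using (upTo-∷ʳ; map-upTo; map-tabulate)
  open import Data.List.Relation.Unary.Any using (here; there)
  open import Data.Nat using (ℕ; zero; suc; _≤_; _<_; _>_; _≟_; _<?_)
  open import Data.Nat.Properties
    using (<-cmp; <-irrefl; <-asym; ≤-pred; n<1+n; m<n⇒m<1+n; <-≤-trans; ≤∧≢⇒<; ≤⇒≯)
  open import Function using (id; _∘_)
  open import Relation.Binary.Definitions using (Tri; tri<; tri≈; tri>)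
  open import Relation.Binary.PropositionalEquality
  open import Relation.Nullary using (Dec; does; yes; no; contradiction)
  open import Relation.Nullary.Decidable using (dec-true; dec-false)

  open CommutativeSemiring R using (_+_; _*_; 0#; 1#) renaming (Carrier to A)
  private
    variable B C : Set
    module R = CommutativeSemiring R
    +-assoc : ∀ x y z → (x + y) + z ≡ x + (y + z)
    +-assoc x y z = ≈⇒≡ (R.+-assoc x y z)
    +-comm : ∀ x y → x + y ≡ y + x
    +-comm x y = ≈⇒≡ (R.+-comm x y)
    +-identityˡ : ∀ x → 0# + x ≡ x
    +-identityˡ x = ≈⇒≡ (R.+-identityˡ x)
    +-identityʳ : ∀ x → x + 0# ≡ x
    +-identityʳ x = ≈⇒≡ (R.+-identityʳ x)
    *-identityˡ : ∀ x → 1# * x ≡ x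
    *-identityˡ x = ≈⇒≡ (R.*-identityˡ x)
    *-comm : ∀ x y → x * y ≡ y * x
    *-comm x y = ≈⇒≡ (R.*-comm x y)
    zeroˡ : ∀ x → 0# * x ≡ 0#
    zeroˡ x = ≈⇒≡ (R.zeroˡ x)
    zeroʳ : ∀ x → x * 0# ≡ 0#
    zeroʳ x = ≈⇒≡ (R.zeroʳ x)
    distribˡ : ∀ x y z → x * (y + z) ≡ x * y + x * z
    distribˡ x y z = ≈⇒≡ (R.distribˡ x y z)
  open ≡-Reasoning

  ∑ : List B → (B → A) → A
  ∑ xs f = foldr (λ x s → f x + s) 0# xs

  𝟙 : Bool → A
  𝟙 true  = 1#
  𝟙 false = 0#

  x*[y*z]≡y*[x*z] : ∀ x y z → x * (y * z) ≡ y * (x * z)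
  x*[y*z]≡y*[x*z] x y z = ≈⇒≡ (x∙yz≈y∙xz x y z)
    where open import Algebra.Properties.CommutativeSemigroup R.*-commutativeSemigroup using (x∙yz≈y∙xz)

  𝟙[_] : {P : Set} → Dec P → A
  𝟙[ p? ] = 𝟙 (does p?)

  𝟙-*-cong : ∀ {P : Set} (p? : Dec P) {x y} → (P → x ≡ y) → 𝟙[ p? ] * x ≡ 𝟙[ p? ] * y
  𝟙-*-cong (yes p) x≡y = cong (1# *_) (x≡y p)
  𝟙-*-cong (no _)  _   = trans (zeroˡ _) (sym (zeroˡ _))

  𝟙-∧ : ∀ a b → 𝟙 (a ∧ b) ≡ 𝟙 a * 𝟙 b
  𝟙-∧ true  b = sym (*-identityˡ (𝟙 b))
  𝟙-∧ false b = sym (zeroˡ (𝟙 b))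

  ∑-++ : ∀ (xs ys : List B) f → ∑ (xs ++ ys) f ≡ ∑ xs f + ∑ ys f
  ∑-++ []       ys f = sym (+-identityˡ _)
  ∑-++ (x ∷ xs) ys f = trans (cong (f x +_) (∑-++ xs ys f)) (sym (+-assoc _ _ _))

  ∑-cong-∈ : ∀ (xs : List B) {f g} → (∀ {x} → x ∈ xs → f x ≡ g x) → ∑ xs f ≡ ∑ xs g
  ∑-cong-∈ []       e = refl
  ∑-cong-∈ (x ∷ xs) e = cong₂ _+_ (e (here refl)) (∑-cong-∈ xs (e ∘ there))

  ∑-cong : ∀ (xs : List B) {f g} → (∀ x → f x ≡ g x) → ∑ xs f ≡ ∑ xs g
  ∑-cong xs e = ∑-cong-∈ xs (λ {x} _ → e x)

  ∑-zero : ∀ (xs : List B) → ∑ xs (λ _ → 0#) ≡ 0#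
  ∑-zero []       = refl
  ∑-zero (x ∷ xs) = trans (+-identityˡ _) (∑-zero xs)

  ∑-vanish : ∀ (xs : List B) {f} → (∀ x → f x ≡ 0#) → ∑ xs f ≡ 0#
  ∑-vanish xs e = trans (∑-cong xs e) (∑-zero xs)

  ∑-+ : ∀ (xs : List B) f g → ∑ xs (λ x → f x + g x) ≡ ∑ xs f + ∑ xs g
  ∑-+ []       f g = sym (+-identityˡ 0#)
  ∑-+ (x ∷ xs) f g = begin
    (f x + g x) + ∑ xs (λ y → f y + g y) ≡⟨ cong ((f x + g x) +_) (∑-+ xs f g) ⟩
    (f x + g x) + (F + G)                ≡⟨ +-assoc (f x) (g x) (F + G) ⟩
    f x + (g x + (F + G))                ≡⟨ cong (f x +_) (sym (+-assoc (g x) F G)) ⟩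
    f x + ((g x + F) + G)                ≡⟨ cong (λ t → f x + (t + G)) (+-comm (g x) F) ⟩
    f x + ((F + g x) + G)                ≡⟨ cong (f x +_) (+-assoc F (g x) G) ⟩
    f x + (F + (g x + G))                ≡⟨ sym (+-assoc (f x) F (g x + G)) ⟩
    (f x + F) + (g x + G)                ∎
    where F = ∑ xs f
          G = ∑ xs g

  ∑-distribˡ : ∀ (xs : List B) c f → c * ∑ xs f ≡ ∑ xs (λ x → c * f x)
  ∑-distribˡ []       c f = zeroʳ c
  ∑-distribˡ (x ∷ xs) c f = trans (distribˡ c _ _) (cong ((c * f x) +_) (∑-distribˡ xs c f))

  ∑-distribʳ : ∀ (xs : List B) c f → ∑ xs f * c ≡ ∑ xs (λ x → f x * c)
  ∑-distribʳ xs c f = begin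
    ∑ xs f * c              ≡⟨ *-comm _ c ⟩
    c * ∑ xs f              ≡⟨ ∑-distribˡ xs c f ⟩
    ∑ xs (λ x → c * f x)    ≡⟨ ∑-cong xs (λ x → *-comm c (f x)) ⟩
    ∑ xs (λ x → f x * c)    ∎

  ∑-map : ∀ (g : C → B) (xs : List C) f → ∑ (map g xs) f ≡ ∑ xs (f ∘ g)
  ∑-map g []       f = refl
  ∑-map g (x ∷ xs) f = cong (f (g x) +_) (∑-map g xs f)

  ∑-concatMap : ∀ (g : C → List B) (xs : List C) f →
                ∑ (concatMap g xs) f ≡ ∑ xs (λ x → ∑ (g x) f)
  ∑-concatMap g []       f = refl
  ∑-concatMap g (x ∷ xs) f =
    trans (∑-++ (g x) (concatMap g xs) f) (cong (∑ (g x) f +_) (∑-concatMap g xs f))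

  ∑-swap : ∀ (xs : List B) (ys : List C) (f : B → C → A) →
           ∑ xs (λ x → ∑ ys (f x)) ≡ ∑ ys (λ y → ∑ xs (λ x → f x y))
  ∑-swap []       ys f = sym (∑-zero ys)
  ∑-swap (x ∷ xs) ys f =
    trans (cong (∑ ys (f x) +_) (∑-swap xs ys f))
          (sym (∑-+ ys (f x) (λ y → ∑ xs (λ x′ → f x′ y))))

  ∑-filterᵇ : ∀ (p : B → Bool) xs f → ∑ (filterᵇ p xs) f ≡ ∑ xs (λ x → 𝟙 (p x) * f x)
  ∑-filterᵇ p []       f = refl
  ∑-filterᵇ p (x ∷ xs) f with p x
  ... | true  = cong₂ _+_ (sym (*-identityˡ (f x))) (∑-filterᵇ p xs f)
  ... | false = trans (∑-filterᵇ p xs f)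
    (sym (trans (cong (_+ ∑ xs (λ y → 𝟙 (p y) * f y)) (zeroˡ (f x))) (+-identityˡ _)))

  ∑-upTo-suc : ∀ n (f : ℕ → A) → ∑ (upTo (suc n)) f ≡ f 0 + ∑ (upTo n) (f ∘ suc)
  ∑-upTo-suc n f =
    cong (f 0 +_) (trans (cong (λ l → ∑ l f) (sym (map-upTo suc n))) (∑-map suc (upTo n) f))

  ∑-allFin-suc : ∀ m (f : Fin (suc m) → A) →
                 ∑ (allFin (suc m)) f ≡ f zero + ∑ (allFin m) (f ∘ suc)
  ∑-allFin-suc m f =
    cong (f zero +_) (trans (cong (λ l → ∑ l f) (sym (map-tabulate id suc))) (∑-map suc (allFin m) f))

  ∑-upTo-∷ʳ : ∀ n (f : ℕ → A) → ∑ (upTo (suc n)) f ≡ ∑ (upTo n) f + f n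
  ∑-upTo-∷ʳ n f = begin
    ∑ (upTo (suc n)) f            ≡⟨ cong (λ l → ∑ l f) (sym (upTo-∷ʳ n)) ⟩
    ∑ (upTo n ++ n ∷ []) f        ≡⟨ ∑-++ (upTo n) (n ∷ []) f ⟩
    ∑ (upTo n) f + (f n + 0#)     ≡⟨ cong (∑ (upTo n) f +_) (+-identityʳ (f n)) ⟩
    ∑ (upTo n) f + f n            ∎

  ∑-upTo-δ : ∀ n c (f : ℕ → A) → ∑ (upTo n) (λ x → 𝟙[ x ≟ c ] * f x) ≡ 𝟙[ c <? n ] * f c
  ∑-upTo-δ zero    c f = sym (zeroˡ (f c))
  ∑-upTo-δ (suc n) c f = begin
    ∑ (upTo (suc n)) g              ≡⟨ ∑-upTo-∷ʳ n g ⟩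
    ∑ (upTo n) g + g n              ≡⟨ cong (_+ g n) (∑-upTo-δ n c f) ⟩
    𝟙[ c <? n ] * f c + g n         ≡⟨ lastTerm (<-cmp c n) ⟩
    𝟙[ c <? suc n ] * f c           ∎
    where
    g = λ x → 𝟙[ x ≟ c ] * f x
    lastTerm : Tri (c < n) (c ≡ n) (c > n) → 𝟙[ c <? n ] * f c + g n ≡ 𝟙[ c <? suc n ] * f c
    lastTerm (tri< c<n _ _) rewrite dec-false (n ≟ c) (λ n≡c → <-irrefl (sym n≡c) c<n)
                              | dec-true (c <? n) c<n | dec-true (c <? suc n) (m<n⇒m<1+n c<n) =
      trans (cong (1# * f c +_) (zeroˡ (f n))) (+-identityʳ _)
    lastTerm (tri≈ _ refl _) rewrite dec-true (c ≟ c) refl | dec-false (c <? c) (<-irrefl refl)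
                               | dec-true (c <? suc c) (n<1+n c) =
      trans (cong (_+ 1# * f c) (zeroˡ (f c))) (+-identityˡ _)
    lastTerm (tri> _ _ n<c) rewrite dec-false (n ≟ c) (λ n≡c → <-irrefl n≡c n<c)
                              | dec-false (c <? n) (<-asym n<c)
                              | dec-false (c <? suc n) (λ c<1+n → <-irrefl refl (<-≤-trans n<c (≤-pred c<1+n))) =
      trans (cong (0# * f c +_) (zeroˡ (f n))) (+-identityʳ _)

  ∑-upTo-restrict : ∀ {k n} (f : ℕ → A) → k ≤ n →
                    ∑ (upTo n) (λ x → 𝟙[ x <? k ] * f x) ≡ ∑ (upTo k) f
  ∑-upTo-restrict {k} {n} f k≤n with k ≟ n
  ... | yes refl = ∑-cong-∈ (upTo k) (λ {x} x∈ →
    trans (cong (λ b → 𝟙 b * f x) (dec-true (x <? k) (∈-upTo⁻ x∈))) (*-identityˡ (f x)))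
  ∑-upTo-restrict {zero} {zero} f _ | no 0≢0 = contradiction refl 0≢0
  ∑-upTo-restrict {k} {suc n} f k≤1+n | no k≢1+n = begin
    ∑ (upTo (suc n)) g  ≡⟨ ∑-upTo-∷ʳ n g ⟩
    ∑ (upTo n) g + g n  ≡⟨ cong₂ _+_ (∑-upTo-restrict f k≤n) beyond ⟩
    ∑ (upTo k) f + 0#   ≡⟨ +-identityʳ _ ⟩
    ∑ (upTo k) f        ∎
    where
    g = λ x → 𝟙[ x <? k ] * f x
    k≤n : k ≤ n
    k≤n = ≤-pred (≤∧≢⇒< k≤1+n k≢1+n)
    beyond : g n ≡ 0#
    beyond rewrite dec-false (n <? k) (≤⇒≯ k≤n) = zeroˡ (f n)

module Distinct where

  open import Data.Bool using (true; false; not; T)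
  open import Data.Bool.Properties using (T-∧; T-≡; ¬-not)
  open import Data.List using (List; []; _∷_; _++_)
  open import Data.List.Membership.Propositional using (_∈_)
  open import Data.List.Membership.Propositional.Properties using (∈-++⁺ʳ)
  open import Data.List.Relation.Binary.Permutation.Propositional using (_↭_; ↭⇒↭ₛ; ↭-sym)
  open import Data.List.Relation.Binary.Permutation.Setoid.Properties using (Unique-resp-↭)
  import Data.List.Relation.Unary.All as All
  open import Data.List.Relation.Unary.All.Properties using (all⁺; all⁻; ++⁻ˡ)
  open import Data.List.Relation.Unary.AllPairs using ([]; _∷_)
  open import Data.List.Relation.Unary.Any using (here; there)
  open import Data.List.Relation.Unary.Unique.Propositional using (Unique)
  open import Data.Nat using (ℕ; _≟_)
  open import Data.List.Relation.Unary.Unique.DecPropositional _≟_ using (unique?)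
  open import Data.Nat.Properties using (≡ᵇ⇒≡; ≡⇒≡ᵇ)
  open import Data.Product using (_,_)
  open import Function using (_∘_; Equivalence; mk⇔)
  open import Relation.Binary.PropositionalEquality
  open import Relation.Nullary using (¬_; does; yes; no)
  open import Relation.Nullary.Decidable using (does-⇔)
  open import Relation.Unary using (Decidable)

  open import Defs using (distinctᵇ)

  distinct? : Decidable (Unique {A = ℕ})
  distinct? = unique?

  private
    T-not⇒¬T : ∀ {b} → T (not b) → ¬ T b
    T-not⇒¬T {false} _ ()

    ¬T⇒T-not : ∀ {b} → ¬ T b → T (not b)
    ¬T⇒T-not {false} _ = _
    ¬T⇒T-not {true}  ¬t with () ← ¬t _

    distinctᵇ⇒Unique : ∀ xs → T (distinctᵇ xs) → Unique xs
    distinctᵇ⇒Unique []       _ = []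
    distinctᵇ⇒Unique (x ∷ xs) t with x∉xs , u ← Equivalence.to T-∧ t =
      All.map (λ ne x≡y → T-not⇒¬T ne (≡⇒≡ᵇ _ _ x≡y)) (all⁺ _ xs x∉xs)
      ∷ distinctᵇ⇒Unique xs u

    Unique⇒distinctᵇ : ∀ {xs} → Unique xs → T (distinctᵇ xs)
    Unique⇒distinctᵇ []         = _
    Unique⇒distinctᵇ (x∉xs ∷ u) =
      Equivalence.from T-∧
        (all⁻ _ (All.map (λ x≢y → ¬T⇒T-not (x≢y ∘ ≡ᵇ⇒≡ _ _)) x∉xs) , Unique⇒distinctᵇ u)

  distinctᵇ≡does : ∀ xs → distinctᵇ xs ≡ does (distinct? xs)
  distinctᵇ≡does xs with distinct? xs
  ... | yes u  = Equivalence.to T-≡ (Unique⇒distinctᵇ u)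
  ... | no ¬u = ¬-not (¬u ∘ distinctᵇ⇒Unique xs ∘ Equivalence.from T-≡)

  distinct?-resp-↭ : ∀ {xs ys} → xs ↭ ys → does (distinct? xs) ≡ does (distinct? ys)
  distinct?-resp-↭ p = does-⇔
    (mk⇔ (Unique-resp-↭ (setoid ℕ) (↭⇒↭ₛ p))
          (Unique-resp-↭ (setoid ℕ) (↭⇒↭ₛ (↭-sym p))))
    (distinct? _) (distinct? _)

  module _ {A : Set} where

    Unique-++⁻ˡ : ∀ (xs : List A) {ys} → Unique (xs ++ ys) → Unique xs
    Unique-++⁻ˡ []       _        = []
    Unique-++⁻ˡ (x ∷ xs) (x∉ ∷ u) = ++⁻ˡ xs x∉ ∷ Unique-++⁻ˡ xs u

    Unique-++⁻ʳ : ∀ (xs : List A) {ys} → Unique (xs ++ ys) → Unique ys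
    Unique-++⁻ʳ []       u       = u
    Unique-++⁻ʳ (x ∷ xs) (_ ∷ u) = Unique-++⁻ʳ xs u

    Unique-++-shared : ∀ {xs ys} {z : A} → z ∈ xs → z ∈ ys → ¬ Unique (xs ++ ys)
    Unique-++-shared {x ∷ xs} (here refl) z∈ys (x∉ ∷ _) = All.lookup x∉ (∈-++⁺ʳ xs z∈ys) refl
    Unique-++-shared (there z∈xs) z∈ys (_ ∷ u) = Unique-++-shared z∈xs z∈ys u

module Runs where

  open import Data.List using (List; []; _∷_; _++_; [_]; reverse; length)
  open import Data.List.Properties using (∷-injective; reverse-++)
  open import Data.List.Membership.Propositional using (_∈_)
  open import Data.List.Relation.Binary.Permutation.Propositional using (_↭_; ↭-refl; ↭-sym; ↭⇒↭ₛ)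
  open import Data.List.Relation.Binary.Permutation.Propositional.Properties using (↭-reverse; ∈-resp-↭)
  open import Data.List.Relation.Binary.Permutation.Setoid.Properties using (Unique-resp-↭)
  open import Data.List.Relation.Unary.All as All using (All)
  open import Data.List.Relation.Unary.AllPairs using ([]; _∷_)
  open import Data.List.Relation.Unary.Any using (here; there)
  open import Data.List.Relation.Unary.Linked using (Linked; []; [-]; _∷_; linked?)
  open import Data.List.Relation.Unary.Unique.Propositional using (Unique)
  open import Data.Nat using (ℕ; zero; suc; _+_; _≤_; _<_; _≟_; z<s)
  open import Data.Nat.Properties
  open import Data.Product using (_×_; _,_; proj₁)
  open import Data.Sum using (_⊎_; inj₁; inj₂)
  open import Function using (_∘_)
  open import Relation.Binary.Definitions using (Decidable)
  import Relation.Unary as U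
  open import Relation.Binary.PropositionalEquality hiding ([_])
  open import Relation.Nullary using (yes; no; contradiction)
  open import Relation.Nullary.Decidable using (_⊎-dec_)

  Adjacent : ℕ → ℕ → Set
  Adjacent x y = suc x ≡ y ⊎ suc y ≡ x

  adjacent? : Decidable Adjacent
  adjacent? x y = (suc x ≟ y) ⊎-dec (suc y ≟ x)

  Walk : List ℕ → Set
  Walk = Linked Adjacent

  walk? : U.Decidable Walk
  walk? = linked? adjacent?

  ascending : ℕ → ℕ → List ℕ
  ascending s zero    = []
  ascending s (suc k) = s ∷ ascending (suc s) k

  descending : ℕ → ℕ → List ℕ
  descending s zero    = []
  descending s (suc k) = s + k ∷ descending s k

  length-ascending : ∀ s k → length (ascending s k) ≡ k
  length-ascending s zero    = refl
  length-ascending s (suc k) = cong suc (length-ascending (suc s) k)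

  length-descending : ∀ s k → length (descending s k) ≡ k
  length-descending s zero    = refl
  length-descending s (suc k) = cong suc (length-descending s k)

  ∈-ascending⁻ : ∀ s k {x} → x ∈ ascending s k → s ≤ x × x < s + k
  ∈-ascending⁻ s (suc k) (here refl) = ≤-refl , m<m+n s z<s
  ∈-ascending⁻ s (suc k) {x} (there x∈) with s<x , x<1+s+k ← ∈-ascending⁻ (suc s) k x∈ =
    <⇒≤ s<x , subst (x <_) (sym (+-suc s k)) x<1+s+k

  ∈-ascending⁺ : ∀ s k {x} → s ≤ x → x < s + k → x ∈ ascending s k
  ∈-ascending⁺ s zero    s≤x x<s+0 =
    contradiction (≤-trans x<s+0 (≤-reflexive (+-identityʳ s))) (≤⇒≯ s≤x)
  ∈-ascending⁺ s (suc k) {x} s≤x x<s+1+k with s ≟ x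
  ... | yes refl = here refl
  ... | no s≢x   =
    there (∈-ascending⁺ (suc s) k (≤∧≢⇒< s≤x s≢x) (subst (x <_) (+-suc s k) x<s+1+k))

  ascending-∷ʳ : ∀ s k → ascending s (suc k) ≡ ascending s k ++ [ s + k ]
  ascending-∷ʳ s zero    = cong [_] (sym (+-identityʳ s))
  ascending-∷ʳ s (suc k) = cong (s ∷_) (trans (ascending-∷ʳ (suc s) k)
    (cong (λ t → ascending (suc s) k ++ [ t ]) (sym (+-suc s k))))

  descending≡reverse-ascending : ∀ s k → descending s k ≡ reverse (ascending s k)
  descending≡reverse-ascending s zero    = refl
  descending≡reverse-ascending s (suc k) = begin
    s + k ∷ descending s k                   ≡⟨ cong (s + k ∷_) (descending≡reverse-ascending s k) ⟩
    s + k ∷ reverse (ascending s k)          ≡⟨ sym (reverse-++ (ascending s k) [ s + k ]) ⟩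
    reverse (ascending s k ++ [ s + k ])     ≡⟨ cong reverse (sym (ascending-∷ʳ s k)) ⟩
    reverse (ascending s (suc k))            ∎
    where open ≡-Reasoning

  descending↭ascending : ∀ s k → descending s k ↭ ascending s k
  descending↭ascending s k =
    subst (_↭ ascending s k) (sym (descending≡reverse-ascending s k)) (↭-reverse (ascending s k))

  Unique-ascending : ∀ s k → Unique (ascending s k)
  Unique-ascending s zero    = []
  Unique-ascending s (suc k) =
    All.tabulate (λ x∈ s≡x → <-irrefl s≡x (proj₁ (∈-ascending⁻ (suc s) k x∈)))
    ∷ Unique-ascending (suc s) k

  Walk-ascending : ∀ s k → Walk (ascending s k)
  Walk-ascending s zero          = []
  Walk-ascending s (suc zero)    = [-]
  Walk-ascending s (suc (suc k)) = inj₁ refl ∷ Walk-ascending (suc s) (suc k)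

  Walk-descending : ∀ s k → Walk (descending s k)
  Walk-descending s zero          = []
  Walk-descending s (suc zero)    = [-]
  Walk-descending s (suc (suc k)) = inj₂ (sym (+-suc s k)) ∷ Walk-descending s (suc k)

  data Direction : Set where
    ↑ ↓ : Direction

  run : Direction → ℕ → ℕ → List ℕ
  run ↑ = ascending
  run ↓ = descending

  -- A run of one cell is both ascending and descending, and is counted once.
  directions : ℕ → List Direction
  directions (suc (suc _)) = ↑ ∷ ↓ ∷ []
  directions _             = ↑ ∷ []

  run↭ascending : ∀ d s k → run d s k ↭ ascending s k
  run↭ascending ↑ s k = ↭-refl
  run↭ascending ↓ s k = descending↭ascending s k

  ∈-run⁻ : ∀ d s k {x} → x ∈ run d s k → s ≤ x × x < s + k
  ∈-run⁻ d s k = ∈-ascending⁻ s k ∘ ∈-resp-↭ (run↭ascending d s k)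

  ∈-run⁺ : ∀ d s k {x} → s ≤ x → x < s + k → x ∈ run d s k
  ∈-run⁺ d s k s≤x x<s+k = ∈-resp-↭ (↭-sym (run↭ascending d s k)) (∈-ascending⁺ s k s≤x x<s+k)

  Unique-run : ∀ d s k → Unique (run d s k)
  Unique-run d s k =
    Unique-resp-↭ (setoid ℕ) (↭⇒↭ₛ (↭-sym (run↭ascending d s k))) (Unique-ascending s k)

  Walk-run : ∀ d s k → Walk (run d s k)
  Walk-run ↑ = Walk-ascending
  Walk-run ↓ = Walk-descending

  length-run : ∀ d s k → length (run d s k) ≡ k
  length-run ↑ = length-ascending
  length-run ↓ = length-descending

  data IsRun : List ℕ → Set where
    ascending-run  : ∀ s k → IsRun (ascending s (suc k))
    descending-run : ∀ s k → IsRun (descending s (suc (suc k)))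

  -- A ±1 walk that never repeats a value cannot turn back.
  distinctWalk⇒IsRun : ∀ {x r} → Walk (x ∷ r) → Unique (x ∷ r) → IsRun (x ∷ r)
  distinctWalk⇒IsRun {x} {[]} _ _ = ascending-run x 0
  distinctWalk⇒IsRun {x} {y ∷ r} (x~y ∷ walk) (x∉ ∷ unique) with distinctWalk⇒IsRun walk unique | x~y
  ... | ascending-run _ k        | inj₁ refl = ascending-run x (suc k)
  ... | ascending-run _ zero     | inj₂ refl =
    subst IsRun (cong₂ (λ a b → a ∷ b ∷ []) (+-comm y 1) (+-identityʳ y)) (descending-run y 0)
  ... | ascending-run _ (suc k)  | inj₂ refl = contradiction refl (All.lookup x∉ (there (here refl)))
  ... | descending-run s k       | inj₂ refl =
    subst IsRun (cong (_∷ y ∷ r) (+-suc s (suc k))) (descending-run s (suc k))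
  ... | descending-run s k       | inj₁ 1+x≡y =
    contradiction (suc-injective (trans 1+x≡y (+-suc s k))) (All.lookup x∉ (there (here refl)))

  run-injective : ∀ d k {s t} → run d s (suc k) ≡ run d t (suc k) → s ≡ t
  run-injective ↑ k eq = proj₁ (∷-injective eq)
  run-injective ↓ k eq = +-cancelʳ-≡ _ _ _ (proj₁ (∷-injective eq))

  ascending≢descending : ∀ k s t → ascending s (suc (suc k)) ≢ descending t (suc (suc k))
  ascending≢descending k s t eq with s≡ , eq′ ← ∷-injective eq with 1+s≡ , _ ← ∷-injective eq′ =
    <-irrefl (trans (trans s≡ (+-suc t k)) (cong suc (sym 1+s≡))) (m<n⇒m<1+n (n<1+n s))

module Words where

  open import Data.Bool using (_∧_)
  open import Data.List using (List; []; _∷_; _++_; map; concatMap; upTo; length)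
  open import Data.List.Membership.Propositional using (_∈_; find)
  open import Data.List.Membership.Propositional.Properties using (∈-concatMap⁻; ∈-map⁻; ∈-upTo⁻)
  open import Data.List.Properties using (≡-dec)
  open import Data.List.Relation.Unary.All using (All; []; _∷_; all?)
  open import Data.List.Relation.Unary.Any using (here)
  open import Data.Nat using (ℕ; zero; suc; _+_; _*_; _<_; _≟_; _<?_)
  open import Data.Nat.Properties using (+-*-commutativeSemiring; +-identityʳ; *-assoc; suc-injective)
  open import Data.Product using (_×_; _,_)
  open import Function using (id)
  open import Relation.Binary.Definitions using (DecidableEquality)
  open import Relation.Binary.PropositionalEquality
  open import Relation.Nullary using (does)

  open ListSum +-*-commutativeSemiring id

  words : ℕ → ℕ → List (List ℕ)
  words B zero    = [] ∷ []
  words B (suc k) = concatMap (λ x → map (x ∷_) (words B k)) (upTo B)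

  infix 4 _≟ₗ_
  _≟ₗ_ : DecidableEquality (List ℕ)
  _≟ₗ_ = ≡-dec _≟_

  module _ {B : ℕ} where

    ∑-words-suc : ∀ k (F : List ℕ → ℕ) →
                  ∑ (words B (suc k)) F ≡ ∑ (upTo B) (λ x → ∑ (words B k) (λ v → F (x ∷ v)))
    ∑-words-suc k F =
      trans (∑-concatMap _ (upTo B) F) (∑-cong (upTo B) (λ x → ∑-map (x ∷_) (words B k) F))

    ∑-words-+ : ∀ a b (F : List ℕ → ℕ) →
                ∑ (words B (a + b)) F ≡ ∑ (words B a) (λ u → ∑ (words B b) (λ v → F (u ++ v)))
    ∑-words-+ zero    b F = sym (+-identityʳ _)
    ∑-words-+ (suc a) b F = begin
      ∑ (words B (suc (a + b))) F
        ≡⟨ ∑-words-suc (a + b) F ⟩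
      ∑ (upTo B) (λ x → ∑ (words B (a + b)) (λ w → F (x ∷ w)))
        ≡⟨ ∑-cong (upTo B) (λ x → ∑-words-+ a b (λ w → F (x ∷ w))) ⟩
      ∑ (upTo B) (λ x → ∑ (words B a) (λ u → ∑ (words B b) (λ v → F (x ∷ u ++ v))))
        ≡⟨ sym (∑-words-suc a _) ⟩
      ∑ (words B (suc a)) (λ u → ∑ (words B b) (λ v → F (u ++ v))) ∎
      where open ≡-Reasoning

    ∈-words⁻ : ∀ k {u} → u ∈ words B k → length u ≡ k × All (_< B) u
    ∈-words⁻ zero    (here refl) = refl , []
    ∈-words⁻ (suc k) u∈
      with x , x∈ , v∈ ← find (∈-concatMap⁻ _ {xs = upTo B} u∈) with v , v∈ , refl ← ∈-map⁻ _ v∈ =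
      let |v| , v<B = ∈-words⁻ k v∈ in cong suc |v| , ∈-upTo⁻ x∈ ∷ v<B

    ∑-words-δ : ∀ k t (f : List ℕ → ℕ) → length t ≡ k →
                ∑ (words B k) (λ u → 𝟙[ u ≟ₗ t ] * f u) ≡ 𝟙[ all? (_<? B) t ] * f t
    ∑-words-δ zero    []      f _ = +-identityʳ _
    ∑-words-δ (suc k) (y ∷ t) f |t| = begin
      ∑ (words B (suc k)) (λ u → 𝟙[ u ≟ₗ (y ∷ t) ] * f u)
        ≡⟨ ∑-words-suc k _ ⟩
      ∑ (upTo B) (λ x → ∑ (words B k) (λ v → 𝟙 (does (x ≟ y) ∧ does (v ≟ₗ t)) * f (x ∷ v)))
        ≡⟨ ∑-cong (upTo B) (λ x → ∑-cong (words B k) (λ v →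
             trans (cong (_* f (x ∷ v)) (𝟙-∧ (does (x ≟ y)) _)) (*-assoc 𝟙[ x ≟ y ] _ _))) ⟩
      ∑ (upTo B) (λ x → ∑ (words B k) (λ v → 𝟙[ x ≟ y ] * (𝟙[ v ≟ₗ t ] * f (x ∷ v))))
        ≡⟨ ∑-cong (upTo B) (λ x → sym (∑-distribˡ (words B k) 𝟙[ x ≟ y ] _)) ⟩
      ∑ (upTo B) (λ x → 𝟙[ x ≟ y ] * ∑ (words B k) (λ v → 𝟙[ v ≟ₗ t ] * f (x ∷ v)))
        ≡⟨ ∑-cong (upTo B) (λ x → cong (𝟙[ x ≟ y ] *_) (∑-words-δ k t (λ v → f (x ∷ v)) (suc-injective |t|))) ⟩
      ∑ (upTo B) (λ x → 𝟙[ x ≟ y ] * (𝟙[ all? (_<? B) t ] * f (x ∷ t)))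
        ≡⟨ ∑-upTo-δ B y (λ x → 𝟙[ all? (_<? B) t ] * f (x ∷ t)) ⟩
      𝟙[ y <? B ] * (𝟙[ all? (_<? B) t ] * f (y ∷ t))
        ≡⟨ sym (*-assoc 𝟙[ y <? B ] _ _) ⟩
      𝟙[ y <? B ] * 𝟙[ all? (_<? B) t ] * f (y ∷ t)
        ≡⟨ cong (_* f (y ∷ t)) (sym (𝟙-∧ (does (y <? B)) _)) ⟩
      𝟙[ all? (_<? B) (y ∷ t) ] * f (y ∷ t) ∎
      where open ≡-Reasoning

module Count where

  open import Data.Nat using (ℕ; suc; _+_; _*_; _∸_; _≤_; _<_; _≤?_; _≟_; _!)
  open import Data.Nat.Combinatorics using (_C_; nCn≡1; nCk+nC[k+1]≡[n+1]C[k+1])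
  open import Data.Nat.Properties
  open import Function using (id; _∘_; mk⇔)
  open import Relation.Binary.PropositionalEquality
  open import Relation.Nullary using (does; yes; no)
  open import Relation.Nullary.Decidable using (dec-true; dec-false; does-⇔)

  open ListSum +-*-commutativeSemiring id

  -- m! orders of the m intervals, times C(n - L + m, m) ways to spread the n - L empty cells over
  -- the m + 1 gaps between them.
  arrangements : ℕ → ℕ → ℕ → ℕ
  arrangements n L m = 𝟙[ L ≤? n ] * (m ! * ((n ∸ L + m) C m))

  arrangements-overfull : ∀ {n L} m → n < L → arrangements n L m ≡ 0
  arrangements-overfull {n} {L} m n<L rewrite dec-false (L ≤? n) (<⇒≱ n<L) = refl

  arrangements-diag : ∀ n m → arrangements n n m ≡ m !
  arrangements-diag n m rewrite dec-true (n ≤? n) ≤-refl | n∸n≡0 n | nCn≡1 m =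
    trans (+-identityʳ _) (*-identityʳ (m !))

  arrangements-shift : ∀ n a r m → 𝟙[ a ≤? n ] * arrangements (n ∸ a) r m ≡ arrangements n (a + r) m
  arrangements-shift n a r m with a ≤? n
  ... | no a≰n rewrite dec-false (a ≤? n) a≰n | dec-false (a + r ≤? n) (a≰n ∘ m+n≤o⇒m≤o a) = refl
  ... | yes a≤n rewrite dec-true (a ≤? n) a≤n =
    trans (+-identityʳ _) (cong₂ (λ b l → 𝟙 b * (m ! * ((l + m) C m))) fits (∸-+-assoc n a r))
    where
    fits : does (r ≤? n ∸ a) ≡ does (a + r ≤? n)
    fits = does-⇔ (mk⇔ (λ r≤n∸a → subst (_≤ n) (+-comm r a) (m≤o∸n⇒m+n≤o r a≤n r≤n∸a))
                       (λ a+r≤n → m+n≤o⇒m≤o∸n r (subst (_≤ n) (+-comm a r) a+r≤n)))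
                  (r ≤? n ∸ a) (a + r ≤? n)

  factorial-pascal : ∀ N m → suc m ! * (suc N C suc m) + suc m * (m ! * (suc N C m)) ≡ suc m ! * (suc (suc N) C suc m)
  factorial-pascal N m = begin
    suc m ! * (suc N C suc m) + suc m * (m ! * (suc N C m))
      ≡⟨ cong (suc m ! * (suc N C suc m) +_) (sym (*-assoc (suc m) (m !) _)) ⟩
    suc m ! * (suc N C suc m) + suc m ! * (suc N C m)
      ≡⟨ sym (*-distribˡ-+ (suc m !) _ _) ⟩
    suc m ! * ((suc N C suc m) + (suc N C m))
      ≡⟨ cong (suc m ! *_) (trans (+-comm (suc N C suc m) _) (nCk+nC[k+1]≡[n+1]C[k+1] (suc N) m)) ⟩
    suc m ! * (suc (suc N) C suc m) ∎
    where open ≡-Reasoning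

  arrangements-suc : ∀ n L m →
    arrangements n L (suc m) + suc m * arrangements (suc n) L m ≡ arrangements (suc n) L (suc m)
  arrangements-suc n L m with L ≤? n
  ... | yes L≤n rewrite dec-true (L ≤? n) L≤n | dec-true (L ≤? suc n) (m≤n⇒m≤1+n L≤n)
                      | +-∸-assoc 1 L≤n | +-suc (n ∸ L) m = begin
    (suc m ! * (suc N C suc m) + 0) + suc m * ((m ! * (suc N C m)) + 0)
      ≡⟨ cong₂ (λ a b → a + suc m * b) (+-identityʳ (suc m ! * (suc N C suc m))) (+-identityʳ (m ! * (suc N C m))) ⟩
    suc m ! * (suc N C suc m) + suc m * (m ! * (suc N C m))
      ≡⟨ factorial-pascal N m ⟩
    suc m ! * (suc (suc N) C suc m)
      ≡⟨ sym (+-identityʳ _) ⟩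
    suc m ! * (suc (suc N) C suc m) + 0 ∎
    where
    open ≡-Reasoning
    N = n ∸ L + m
  ... | no L≰n rewrite dec-false (L ≤? n) L≰n with L ≟ suc n
  ...   | yes refl rewrite n∸n≡0 n | nCn≡1 m | dec-true (suc n ≤? suc n) ≤-refl | nCn≡1 (suc m) =
    trans (cong (suc m *_) (trans (+-identityʳ _) (*-identityʳ (m !))))
          (sym (trans (+-identityʳ _) (*-identityʳ _)))
  ...   | no L≢1+n
    rewrite dec-false (L ≤? suc n) (λ L≤1+n → L≢1+n (≤-antisym L≤1+n (≰⇒> L≰n))) = *-zeroʳ (suc m)

module Placements where

  open import Data.Fin using (Fin; zero; suc)
  open import Data.List using (List; []; _∷_; _++_; upTo; length; lookup; removeAt; allFin)
  open import Data.List.Membership.Propositional using (_∈_)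
  open import Data.List.Membership.Propositional.Properties using (∈-++⁺ˡ; ∈-++⁺ʳ; ∈-lookup)
  open import Data.List.Relation.Binary.Disjoint.Propositional using (Disjoint)
  import Data.List.Relation.Unary.Unique.Propositional.Properties as Unique
  import Data.List.Relation.Unary.All.Properties as AllP
  open import Data.List.Relation.Binary.Permutation.Propositional using (_↭_; ↭-trans; ↭-reflexive)
  open import Data.List.Relation.Binary.Permutation.Propositional.Properties using (++⁺ʳ; ++⁺ˡ; ++-comm)
  open import Data.List.Properties using (++-assoc; ++-identityʳ; length-tabulate; length-removeAt′)
  open import Data.List.Relation.Unary.All as All using (All; []; _∷_)
  open import Data.List.Relation.Unary.Unique.Propositional using (Unique)
  open import Data.Nat using (ℕ; zero; suc; _+_; _*_; _∸_; _≤_; _<_; _≟_; _≤?_; _<?_; s≤s)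
  open import Data.Nat.ListAction using (sum)
  open import Data.Nat.Properties
  open import Data.Nat.Induction using (<-rec)
  open import Algebra.Properties.CommutativeSemigroup +-commutativeSemigroup
    using () renaming (x∙yz≈y∙xz to m+[n+o]≡n+[m+o])
  open import Data.Product using (_,_; proj₁; proj₂)
  open import Function using (id; _∘_; mk⇔)
  open import Relation.Binary.PropositionalEquality
  open import Relation.Nullary using (¬_; does; yes; no; contradiction)
  open import Relation.Nullary.Decidable using (dec-true; dec-false; does-⇔)

  open Distinct
  open Runs
  open Count

  open ListSum +-*-commutativeSemiring id

  -- placements B n π P counts the choices of pairwise disjoint intervals [s, s + k), one for each
  -- part k of π in order, inside {0, …, n-1} and avoiding the (distinct) cells listed in P.  Start
  -- points range over upTo B rather than upTo n so that n can change in the induction; B ≥ n throughout.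
  placements : (B n : ℕ) → List ℕ → List ℕ → ℕ
  placements B n []      P = 𝟙[ distinct? P ]
  placements B n (k ∷ π) P = ∑ (upTo B) (λ s → 𝟙[ s + k ≤? n ] * placements B n π (P ++ ascending s k))

  endingAt : (B n : ℕ) (π : List ℕ) → Fin (length π) → List ℕ → ℕ
  endingAt B n (k ∷ π) zero    P =
    ∑ (upTo B) (λ s → 𝟙[ s + k ≟ n ] * placements B n π (P ++ ascending s k))
  endingAt B n (k ∷ π) (suc j) P =
    ∑ (upTo B) (λ s → 𝟙[ s + k ≤? n ] * endingAt B n π j (P ++ ascending s k))

  topInterval : ℕ → ℕ → List ℕ
  topInterval n a = ascending (n ∸ a) a

  All-removeAt : ∀ {P : ℕ → Set} π j → All P π → All P (removeAt π j)
  All-removeAt (k ∷ π) zero    (_ ∷ ps)  = ps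
  All-removeAt (k ∷ π) (suc j) (p ∷ ps) = p ∷ All-removeAt π j ps

  sum-removeAt : ∀ π j → sum π ≡ lookup π j + sum (removeAt π j)
  sum-removeAt (k ∷ π) zero    = refl
  sum-removeAt (k ∷ π) (suc j) = trans (cong (k +_) (sum-removeAt π j)) (m+[n+o]≡n+[m+o] k (lookup π j) _)

  𝟙-≤-suc : ∀ m n → 𝟙[ m ≤? suc n ] ≡ 𝟙[ m ≤? n ] + 𝟙[ m ≟ suc n ]
  𝟙-≤-suc m n with m ≤? n
  ... | yes m≤n rewrite dec-true (m ≤? n) m≤n | dec-true (m ≤? suc n) (m≤n⇒m≤1+n m≤n)
                      | dec-false (m ≟ suc n) (λ m≡1+n → <-irrefl m≡1+n (s≤s m≤n)) = refl
  ... | no m≰n rewrite dec-false (m ≤? n) m≰n with m ≟ suc n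
  ...   | yes refl = cong 𝟙 (trans (dec-true (suc n ≤? suc n) ≤-refl) (sym (dec-true (suc n ≟ suc n) refl)))
  ...   | no m≢1+n = cong 𝟙 (trans
    (dec-false (m ≤? suc n) (λ m≤1+n → m≢1+n (≤-antisym m≤1+n (≰⇒> m≰n))))
    (sym (dec-false (m ≟ suc n) m≢1+n)))

  ∑-const : ∀ {A : Set} (xs : List A) c → ∑ xs (λ _ → c) ≡ length xs * c
  ∑-const []       c = refl
  ∑-const (x ∷ xs) c = cong (c +_) (∑-const xs c)

  ↭-swapʳ : ∀ (P A I : List ℕ) → (P ++ A) ++ I ↭ (P ++ I) ++ A
  ↭-swapʳ P A I = ↭-trans (↭-reflexive (++-assoc P A I))
                 (↭-trans (++⁺ˡ P (++-comm A I)) (↭-reflexive (sym (++-assoc P I A))))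

  module _ {B : ℕ} where

    placements-nonUnique : ∀ {n} π {P} → ¬ Unique P → placements B n π P ≡ 0
    placements-nonUnique []      {P} ¬u with distinct? P
    ... | yes u = contradiction u ¬u
    ... | no _  = refl
    placements-nonUnique {n} (k ∷ π) {P} ¬u = ∑-vanish (upTo B) (λ s →
      trans (cong (𝟙[ s + k ≤? n ] *_) (placements-nonUnique π (¬u ∘ Unique-++⁻ˡ P)))
            (*-zeroʳ 𝟙[ s + k ≤? n ]))

    placements-resp-↭ : ∀ {n} π {P P′} → P ↭ P′ → placements B n π P ≡ placements B n π P′
    placements-resp-↭ []      p = cong 𝟙 (distinct?-resp-↭ p)
    placements-resp-↭ {n} (k ∷ π) p = ∑-cong (upTo B) (λ s →
      cong (𝟙[ s + k ≤? n ] *_) (placements-resp-↭ π (++⁺ʳ (ascending s k) p)))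

    endingAt-head : ∀ {n} k π P → 1 ≤ k → n ≤ B →
      endingAt B n (k ∷ π) zero P ≡ 𝟙[ k ≤? n ] * placements B n π (P ++ ascending (n ∸ k) k)
    endingAt-head {n} k π P 1≤k n≤B with k ≤? n
    ... | no k≰n rewrite dec-false (k ≤? n) k≰n = ∑-vanish (upTo B) (λ s →
      cong (λ b → 𝟙 b * f s)
           (dec-false (s + k ≟ n) (λ s+k≡n → k≰n (subst (k ≤_) s+k≡n (m≤n+m k s)))))
      where f = λ s → placements B n π (P ++ ascending s k)
    ... | yes k≤n rewrite dec-true (k ≤? n) k≤n = begin
      ∑ (upTo B) (λ s → 𝟙[ s + k ≟ n ] * f s)
        ≡⟨ ∑-cong (upTo B) (λ s → cong (λ b → 𝟙 b * f s) (start s)) ⟩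
      ∑ (upTo B) (λ s → 𝟙[ s ≟ n ∸ k ] * f s)
        ≡⟨ ∑-upTo-δ B (n ∸ k) f ⟩
      𝟙[ n ∸ k <? B ] * f (n ∸ k)
        ≡⟨ cong (λ b → 𝟙 b * f (n ∸ k)) (dec-true (n ∸ k <? B) n∸k<B) ⟩
      1 * f (n ∸ k) ∎
      where
      open ≡-Reasoning
      f = λ s → placements B n π (P ++ ascending s k)
      n∸k<B : n ∸ k < B
      n∸k<B = <-≤-trans (∸-monoʳ-< 1≤k k≤n) n≤B
      start : ∀ s → does (s + k ≟ n) ≡ does (s ≟ n ∸ k)
      start s = does-⇔ (mk⇔ (λ s+k≡n → trans (sym (m+n∸n≡m s k)) (cong (_∸ k) s+k≡n))
                            (λ s≡n∸k → trans (cong (_+ k) s≡n∸k) (m∸n+n≡m k≤n)))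
                       (s + k ≟ n) (s ≟ n ∸ k)

    endingAt-lookup : ∀ {n} π j P → All (1 ≤_) π → n ≤ B →
      endingAt B n π j P
        ≡ 𝟙[ lookup π j ≤? n ] * placements B n (removeAt π j) (P ++ topInterval n (lookup π j))
    endingAt-lookup (k ∷ π) zero    P (1≤k ∷ _) n≤B = endingAt-head k π P 1≤k n≤B
    endingAt-lookup {n} (k ∷ π) (suc j) P (_ ∷ pos) n≤B = begin
      ∑ (upTo B) (λ s → 𝟙[ s + k ≤? n ] * endingAt B n π j (P ++ ascending s k))
        ≡⟨ ∑-cong (upTo B) (λ s → cong (𝟙[ s + k ≤? n ] *_)
             (trans (endingAt-lookup π j (P ++ ascending s k) pos n≤B)
                    (cong (c *_) (placements-resp-↭ ρ (↭-swapʳ P (ascending s k) I))))) ⟩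
      ∑ (upTo B) (λ s → 𝟙[ s + k ≤? n ] * (c * placements B n ρ ((P ++ I) ++ ascending s k)))
        ≡⟨ ∑-cong (upTo B) (λ s → x*[y*z]≡y*[x*z] 𝟙[ s + k ≤? n ] c _) ⟩
      ∑ (upTo B) (λ s → c * (𝟙[ s + k ≤? n ] * placements B n ρ ((P ++ I) ++ ascending s k)))
        ≡⟨ sym (∑-distribˡ (upTo B) c _) ⟩
      c * placements B n (k ∷ ρ) (P ++ I) ∎
      where
      open ≡-Reasoning
      c = 𝟙[ lookup π j ≤? n ]
      ρ = removeAt π j
      I = topInterval n (lookup π j)

    placements-topInterval : ∀ {n} l ρ X → l ≤ n → All (1 ≤_) ρ → All (_< n ∸ l) X →
      placements B n ρ (topInterval n l ++ X) ≡ placements B (n ∸ l) ρ X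
    placements-topInterval {n} l [] X l≤n _ X<n∸l = cong 𝟙 (does-⇔
      (mk⇔ (Unique-++⁻ʳ (topInterval n l)) (λ u → Unique.++⁺ (Unique-ascending (n ∸ l) l) u disjoint))
      (distinct? _) (distinct? _))
      where
      disjoint : Disjoint (topInterval n l) X
      disjoint (v∈I , v∈X) = ≤⇒≯ (proj₁ (∈-ascending⁻ (n ∸ l) l v∈I)) (All.lookup X<n∸l v∈X)
    placements-topInterval {n} l (suc k ∷ ρ) X l≤n (_ ∷ pos) X<n∸l = ∑-cong (upTo B) below
      where
      I = topInterval n l
      below : ∀ s → 𝟙[ s + suc k ≤? n ] * placements B n ρ ((I ++ X) ++ ascending s (suc k))
                  ≡ 𝟙[ s + suc k ≤? n ∸ l ] * placements B (n ∸ l) ρ (X ++ ascending s (suc k))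
      below s with s + suc k ≤? n ∸ l
      ... | yes fits rewrite dec-true (s + suc k ≤? n ∸ l) fits
                           | dec-true (s + suc k ≤? n) (≤-trans fits (m∸n≤m n l))
                           | ++-assoc I X (ascending s (suc k)) =
        cong (_+ 0) (placements-topInterval l ρ (X ++ ascending s (suc k)) l≤n pos (AllP.++⁺ X<n∸l block<n∸l))
        where
        block<n∸l : All (_< n ∸ l) (ascending s (suc k))
        block<n∸l = All.tabulate (λ x∈ → <-≤-trans (proj₂ (∈-ascending⁻ s (suc k) x∈)) fits)
      ... | no overlaps rewrite dec-false (s + suc k ≤? n ∸ l) overlaps with s + suc k ≤? n
      ...   | no  s+k≰n rewrite dec-false (s + suc k ≤? n) s+k≰n = refl
      ...   | yes s+k≤n rewrite dec-true (s + suc k ≤? n) s+k≤n =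
        trans (+-identityʳ _) (placements-nonUnique ρ (Unique-++-shared (∈-++⁺ˡ t∈I) t∈block))
        where
        t = s + k
        t<s+1+k : t < s + suc k
        t<s+1+k = +-monoʳ-< s (n<1+n k)
        t∈block : t ∈ ascending s (suc k)
        t∈block = ∈-ascending⁺ s (suc k) (m≤m+n s k) t<s+1+k
        t∈I : t ∈ I
        t∈I = ∈-ascending⁺ (n ∸ l) l (≤-pred (subst (n ∸ l <_) (+-suc s k) (≰⇒> overlaps)))
                            (subst (t <_) (sym (m∸n+n≡m l≤n)) (<-≤-trans t<s+1+k s+k≤n))

    endingAt-weaken : ∀ {n} k π j P s → 1 ≤ k → suc n ≤ B → All (1 ≤_) π →
      𝟙[ s + k ≤? n ] * endingAt B (suc n) π j (P ++ ascending s k)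
        ≡ 𝟙[ s + k ≤? suc n ] * endingAt B (suc n) π j (P ++ ascending s k)
    endingAt-weaken {n} k π j P s 1≤k 1+n≤B pos with s + k ≤? n
    ... | yes s+k≤n rewrite dec-true (s + k ≤? n) s+k≤n
                          | dec-true (s + k ≤? suc n) (m≤n⇒m≤1+n s+k≤n) = refl
    ... | no s+k≰n rewrite dec-false (s + k ≤? n) s+k≰n with s + k ≤? suc n
    ...   | no s+k≰1+n rewrite dec-false (s + k ≤? suc n) s+k≰1+n = refl
    ...   | yes s+k≤1+n rewrite dec-true (s + k ≤? suc n) s+k≤1+n =
      sym (trans (+-identityʳ _) (trans (endingAt-lookup π j (P ++ ascending s k) pos 1+n≤B) both-cover-n))
      where
      a = lookup π j
      s+k≡1+n : s + k ≡ suc n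
      s+k≡1+n = ≤-antisym s+k≤1+n (≰⇒> s+k≰n)
      n∈block : n ∈ ascending s k
      n∈block = ∈-ascending⁺ s k (≤-pred (subst (s <_) s+k≡1+n (m<m+n s 1≤k)))
                                 (subst (n <_) (sym s+k≡1+n) (n<1+n n))
      both-cover-n : 𝟙[ a ≤? suc n ] * placements B (suc n) (removeAt π j) ((P ++ ascending s k) ++ topInterval (suc n) a)
                     ≡ 0
      both-cover-n with a ≤? suc n
      ... | no a≰1+n rewrite dec-false (a ≤? suc n) a≰1+n = refl
      ... | yes a≤1+n rewrite dec-true (a ≤? suc n) a≤1+n =
        trans (+-identityʳ _)
              (placements-nonUnique (removeAt π j) (Unique-++-shared (∈-++⁺ʳ P n∈block) n∈top))
        where
        n∈top : n ∈ topInterval (suc n) a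
        n∈top = ∈-ascending⁺ (suc n ∸ a) a (≤-pred (∸-monoʳ-< (All.lookup pos (∈-lookup j)) a≤1+n))
                              (subst (n <_) (sym (m∸n+n≡m a≤1+n)) (n<1+n n))

    placements-suc : ∀ {n} π P → suc n ≤ B → All (1 ≤_) π →
      placements B (suc n) π P
        ≡ placements B n π P + ∑ (allFin (length π)) (λ j → endingAt B (suc n) π j P)
    placements-suc []      P _ _ = sym (+-identityʳ _)
    placements-suc {n} (k ∷ π) P 1+n≤B (1≤k ∷ pos) = begin
      ∑ (upTo B) (λ s → 𝟙[ s + k ≤? suc n ] * Q₁ s)
        ≡⟨ ∑-cong (upTo B) (λ s → trans (cong (_* Q₁ s) (𝟙-≤-suc (s + k) n))
                                         (*-distribʳ-+ (Q₁ s) 𝟙[ s + k ≤? n ] _)) ⟩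
      ∑ (upTo B) (λ s → 𝟙[ s + k ≤? n ] * Q₁ s + 𝟙[ s + k ≟ suc n ] * Q₁ s)
        ≡⟨ ∑-+ (upTo B) _ _ ⟩
      ∑ (upTo B) (λ s → 𝟙[ s + k ≤? n ] * Q₁ s) + E zero
        ≡⟨ cong (_+ E zero) covered ⟩
      Q₀ + ∑ (allFin (length π)) (E ∘ suc) + E zero
        ≡⟨ +-assoc Q₀ _ _ ⟩
      Q₀ + (∑ (allFin (length π)) (E ∘ suc) + E zero)
        ≡⟨ cong (Q₀ +_) (trans (+-comm _ (E zero)) (sym (∑-allFin-suc (length π) E))) ⟩
      Q₀ + ∑ (allFin (suc (length π))) E ∎
      where
      open ≡-Reasoning
      Q₀ = placements B n (k ∷ π) P
      Q₁ = λ s → placements B (suc n) π (P ++ ascending s k)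
      E = λ j → endingAt B (suc n) (k ∷ π) j P
      E′ = λ j s → endingAt B (suc n) π j (P ++ ascending s k)
      covered : ∑ (upTo B) (λ s → 𝟙[ s + k ≤? n ] * Q₁ s) ≡ Q₀ + ∑ (allFin (length π)) (E ∘ suc)
      covered = begin
        ∑ (upTo B) (λ s → 𝟙[ s + k ≤? n ] * Q₁ s)
          ≡⟨ ∑-cong (upTo B) (λ s → trans
               (cong (𝟙[ s + k ≤? n ] *_) (placements-suc π (P ++ ascending s k) 1+n≤B pos))
               (*-distribˡ-+ 𝟙[ s + k ≤? n ] _ _)) ⟩
        ∑ (upTo B) (λ s → 𝟙[ s + k ≤? n ] * placements B n π (P ++ ascending s k)
                          + 𝟙[ s + k ≤? n ] * ∑ (allFin (length π)) (λ j → E′ j s))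
          ≡⟨ ∑-+ (upTo B) _ _ ⟩
        Q₀ + ∑ (upTo B) (λ s → 𝟙[ s + k ≤? n ] * ∑ (allFin (length π)) (λ j → E′ j s))
          ≡⟨ cong (Q₀ +_) (trans
               (∑-cong (upTo B) (λ s → ∑-distribˡ (allFin (length π)) 𝟙[ s + k ≤? n ] (λ j → E′ j s)))
               (∑-swap (upTo B) (allFin (length π)) _)) ⟩
        Q₀ + ∑ (allFin (length π)) (λ j → ∑ (upTo B) (λ s → 𝟙[ s + k ≤? n ] * E′ j s))
          ≡⟨ cong (Q₀ +_) (∑-cong (allFin (length π)) (λ j → ∑-cong (upTo B) (λ s →
               endingAt-weaken k π j P s 1≤k 1+n≤B pos))) ⟩
        Q₀ + ∑ (allFin (length π)) (E ∘ suc) ∎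

    Counted : ℕ → Set
    Counted n = ∀ π → n ≤ B → All (1 ≤_) π → placements B n π [] ≡ arrangements n (sum π) (length π)

    endingAt-count : ∀ {n} k π j → suc n ≤ B → All (1 ≤_) (k ∷ π) →
      (∀ {n′} → n′ < suc n → Counted n′) →
      endingAt B (suc n) (k ∷ π) j [] ≡ arrangements (suc n) (k + sum π) (length π)
    endingAt-count {n} k π j 1+n≤B pos counted = begin
      endingAt B (suc n) (k ∷ π) j []
        ≡⟨ endingAt-lookup (k ∷ π) j [] pos 1+n≤B ⟩
      𝟙[ a ≤? suc n ] * placements B (suc n) ρ (topInterval (suc n) a)
        ≡⟨ 𝟙-*-cong (a ≤? suc n) (λ a≤1+n → trans
             (cong (placements B (suc n) ρ) (sym (++-identityʳ (topInterval (suc n) a))))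
             (placements-topInterval a ρ [] a≤1+n ρ-pos [])) ⟩
      𝟙[ a ≤? suc n ] * placements B (suc n ∸ a) ρ []
        ≡⟨ 𝟙-*-cong (a ≤? suc n) (λ a≤1+n →
             counted (∸-monoʳ-< 1≤a a≤1+n) ρ (≤-trans (m∸n≤m (suc n) a) 1+n≤B) ρ-pos) ⟩
      𝟙[ a ≤? suc n ] * arrangements (suc n ∸ a) (sum ρ) (length ρ)
        ≡⟨ arrangements-shift (suc n) a (sum ρ) (length ρ) ⟩
      arrangements (suc n) (a + sum ρ) (length ρ)
        ≡⟨ cong₂ (arrangements (suc n)) (sym (sum-removeAt (k ∷ π) j))
                                        (suc-injective (sym (length-removeAt′ (k ∷ π) j))) ⟩
      arrangements (suc n) (k + sum π) (length π) ∎
      where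
      open ≡-Reasoning
      a = lookup (k ∷ π) j
      ρ = removeAt (k ∷ π) j
      1≤a : 1 ≤ a
      1≤a = All.lookup pos (∈-lookup j)
      ρ-pos : All (1 ≤_) ρ
      ρ-pos = All-removeAt (k ∷ π) j pos

    placements-count : ∀ n → Counted n
    placements-count = <-rec Counted count
      where
      count : ∀ n → (∀ {n′} → n′ < n → Counted n′) → Counted n
      count n       counted []      _ _ = refl
      count zero    counted (k ∷ π) _ (1≤k ∷ _) = trans
        (∑-vanish (upTo B) (λ s → cong (λ b → 𝟙 b * placements B 0 π (ascending s k))
          (dec-false (s + k ≤? 0) (λ s+k≤0 → ≤⇒≯ s+k≤0 (<-≤-trans 1≤k (m≤n+m k s))))))
        (sym (arrangements-overfull (length (k ∷ π)) (<-≤-trans 1≤k (m≤m+n k (sum π)))))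
      count (suc n) counted (k ∷ π) 1+n≤B pos = begin
        placements B (suc n) (k ∷ π) []
          ≡⟨ placements-suc (k ∷ π) [] 1+n≤B pos ⟩
        placements B n (k ∷ π) [] + ∑ (allFin (suc m)) (λ j → endingAt B (suc n) (k ∷ π) j [])
          ≡⟨ cong₂ _+_ (counted ≤-refl (k ∷ π) (<⇒≤ 1+n≤B) pos)
                       (∑-cong (allFin (suc m)) (λ j → endingAt-count k π j 1+n≤B pos counted)) ⟩
        arrangements n L (suc m) + ∑ (allFin (suc m)) (λ _ → arrangements (suc n) L m)
          ≡⟨ cong (arrangements n L (suc m) +_) (trans
               (∑-const (allFin (suc m)) (arrangements (suc n) L m))
               (cong (_* arrangements (suc n) L m) (length-tabulate {n = suc m} id))) ⟩
        arrangements n L (suc m) + suc m * arrangements (suc n) L m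
          ≡⟨ arrangements-suc n L m ⟩
        arrangements (suc n) L (suc m) ∎
        where
        open ≡-Reasoning
        L = k + sum π
        m = length π

module WalkWords where

  open import Data.Bool using (_∧_)
  open import Data.Bool.Properties using (∧-identityʳ; ∧-zeroʳ)
  open import Data.List using (List; []; _∷_; _++_; upTo; length; take; drop; map; concatMap)
  open import Data.List.Properties using (++-assoc; ++-identityʳ)
  open import Data.List.Relation.Binary.Permutation.Propositional using (_↭_)
  open import Data.List.Relation.Binary.Permutation.Propositional.Properties using (++⁺ʳ; ++⁺ˡ)
  open import Data.List.Relation.Unary.All as All using (All; _∷_; all?)
  open import Data.List.Relation.Unary.Unique.Propositional using (Unique)
  open import Data.Nat using (ℕ; zero; suc; _+_; _*_; _∸_; _≤_; _<_; _≟_; _≤?_; _<?_; z<s)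
  open import Data.Nat.ListAction using (sum)
  open import Data.Nat.Properties
  open import Data.Product using (_×_; _,_; proj₁; proj₂)
  open import Function using (id; _∘_; mk⇔)
  open import Relation.Binary.PropositionalEquality
  open import Relation.Nullary using (¬_; does; yes; no)
  open import Relation.Nullary.Decidable using (dec-true; dec-false; does-⇔)

  open import Defs using (listsLen)
  open Distinct
  open Runs
  open Words
  open Placements using (placements; ∑-const)

  open ListSum +-*-commutativeSemiring id

  module _ {B : ℕ} where

    ∑-upTo-point : ∀ {c} → c < B → ∑ (upTo B) (λ s → 𝟙[ c ≟ s ]) ≡ 1
    ∑-upTo-point {c} c<B = begin
      ∑ (upTo B) (λ s → 𝟙[ c ≟ s ])
        ≡⟨ ∑-cong (upTo B) (λ s → trans (cong 𝟙 (does-⇔ (mk⇔ sym sym) (c ≟ s) (s ≟ c))) (sym (*-identityʳ _))) ⟩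
      ∑ (upTo B) (λ s → 𝟙[ s ≟ c ] * 1)     ≡⟨ ∑-upTo-δ B c (λ _ → 1) ⟩
      𝟙[ c <? B ] * 1                        ≡⟨ cong (λ b → 𝟙 b * 1) (dec-true (c <? B) c<B) ⟩
      1                                      ∎
      where open ≡-Reasoning

    ∑-run-point : ∀ d k {s₀} → s₀ < B → ∑ (upTo B) (λ s → 𝟙[ run d s₀ (suc k) ≟ₗ run d s (suc k) ]) ≡ 1
    ∑-run-point d k {s₀} s₀<B = trans (∑-cong (upTo B) (λ s → cong 𝟙
      (does-⇔ (mk⇔ (run-injective d k) (cong (λ t → run d t (suc k))))
              (run d s₀ (suc k) ≟ₗ run d s (suc k)) (s₀ ≟ s))))
      (∑-upTo-point s₀<B)

    ∑-ascending-descending : ∀ k s₀ →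
      ∑ (upTo B) (λ s → 𝟙[ ascending s₀ (2 + k) ≟ₗ descending s (2 + k) ]) ≡ 0
    ∑-ascending-descending k s₀ = ∑-vanish (upTo B) (λ s →
      cong 𝟙 (dec-false (ascending s₀ (2 + k) ≟ₗ descending s (2 + k)) (ascending≢descending k s₀ s)))

    ∑-descending-ascending : ∀ k s₀ →
      ∑ (upTo B) (λ s → 𝟙[ descending s₀ (2 + k) ≟ₗ ascending s (2 + k) ]) ≡ 0
    ∑-descending-ascending k s₀ = ∑-vanish (upTo B) (λ s →
      cong 𝟙 (dec-false (descending s₀ (2 + k) ≟ₗ ascending s (2 + k)) (ascending≢descending k s s₀ ∘ sym)))

    nonEmpty⇒IsRun : ∀ {u k} → length u ≡ suc k → Walk u → Unique u → IsRun u
    nonEmpty⇒IsRun {x ∷ r} _ = distinctWalk⇒IsRun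

    notRun : ∀ {u} k → ¬ (Walk u × Unique u) →
      ∑ (directions (suc k)) (λ d → ∑ (upTo B) (λ s → 𝟙[ u ≟ₗ run d s (suc k) ])) ≡ 0
    notRun {u} k ¬run = ∑-vanish (directions (suc k)) (λ d → ∑-vanish (upTo B) (λ s →
      cong 𝟙 (dec-false (u ≟ₗ run d s (suc k))
                        (λ { refl → ¬run (Walk-run d s (suc k) , Unique-run d s (suc k)) }))))

    𝟙-distinctWalk : ∀ k u → length u ≡ suc k → All (_< B) u →
      𝟙 (does (walk? u) ∧ does (distinct? u))
        ≡ ∑ (directions (suc k)) (λ d → ∑ (upTo B) (λ s → 𝟙[ u ≟ₗ run d s (suc k) ]))
    𝟙-distinctWalk k u |u| u<B with walk? u | distinct? u
    ... | no ¬walk | _        = sym (notRun k (¬walk ∘ proj₁))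
    ... | yes _    | no ¬uniq = sym (notRun k (¬uniq ∘ proj₂))
    ... | yes walk | yes uniq with nonEmpty⇒IsRun |u| walk uniq
    ...   | ascending-run s₀ k₀
      with refl ← suc-injective (trans (sym (length-ascending s₀ (suc k₀))) |u|) with k
    ...     | zero   = sym (trans (+-identityʳ _) (∑-run-point ↑ 0 s₀<B))
      where s₀<B : s₀ < B
            s₀<B = All.head u<B
    ...     | suc k′ =
      sym (cong₂ _+_ (∑-run-point ↑ (suc k′) s₀<B) (cong (_+ 0) (∑-ascending-descending k′ s₀)))
      where s₀<B : s₀ < B
            s₀<B = All.head u<B
    𝟙-distinctWalk k u |u| u<B | yes walk | yes uniq | descending-run s₀ k₀
      with refl ← suc-injective (trans (sym (length-descending s₀ (suc (suc k₀)))) |u|) =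
      sym (cong₂ _+_ (∑-descending-ascending k₀ s₀) (cong (_+ 0) (∑-run-point ↓ (suc k₀) s₀<B)))
      where s₀<B : s₀ < B
            s₀<B = ≤-<-trans (m≤m+n s₀ (suc k₀)) (All.head u<B)

    run-fits : ∀ d s k → does (all? (_<? B) (run d s (suc k))) ≡ does (s + suc k ≤? B)
    run-fits d s k = does-⇔
      (mk⇔ last<B (λ fits → All.tabulate (λ x∈ → <-≤-trans (proj₂ (∈-run⁻ d s (suc k) x∈)) fits)))
      (all? (_<? B) (run d s (suc k))) (s + suc k ≤? B)
      where
      last<B : All (_< B) (run d s (suc k)) → s + suc k ≤ B
      last<B all = subst (_≤ B) (sym (+-suc s k))
        (All.lookup all (∈-run⁺ d s (suc k) (m≤m+n s k) (+-monoʳ-< s (n<1+n k))))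

    ∑-distinctWalks : ∀ k (F : List ℕ → ℕ) →
      ∑ (words B (suc k)) (λ u → 𝟙 (does (walk? u) ∧ does (distinct? u)) * F u)
        ≡ ∑ (directions (suc k)) (λ d → ∑ (upTo B) (λ s → 𝟙[ s + suc k ≤? B ] * F (run d s (suc k))))
    ∑-distinctWalks k F = begin
      ∑ (words B (suc k)) (λ u → 𝟙 (does (walk? u) ∧ does (distinct? u)) * F u)
        ≡⟨ ∑-cong-∈ (words B (suc k)) (λ {u} u∈ → let |u| , u<B = ∈-words⁻ (suc k) u∈ in
             cong (_* F u) (𝟙-distinctWalk k u |u| u<B)) ⟩
      ∑ (words B (suc k)) (λ u → ∑ (directions (suc k)) (λ d → ∑ (upTo B) (λ s → δ u d s)) * F u)
        ≡⟨ ∑-cong (words B (suc k)) (λ u → trans (∑-distribʳ (directions (suc k)) (F u) _)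
             (∑-cong (directions (suc k)) (λ d → ∑-distribʳ (upTo B) (F u) (δ u d)))) ⟩
      ∑ (words B (suc k)) (λ u → ∑ (directions (suc k)) (λ d → ∑ (upTo B) (λ s → δ u d s * F u)))
        ≡⟨ trans (∑-swap (words B (suc k)) (directions (suc k)) _)
                 (∑-cong (directions (suc k)) (λ d → ∑-swap (words B (suc k)) (upTo B) _)) ⟩
      ∑ (directions (suc k)) (λ d → ∑ (upTo B) (λ s → ∑ (words B (suc k)) (λ u → δ u d s * F u)))
        ≡⟨ ∑-cong (directions (suc k)) (λ d → ∑-cong (upTo B) (λ s →
             trans (∑-words-δ (suc k) (run d s (suc k)) F (length-run d s (suc k)))
                   (cong (λ b → 𝟙 b * F (run d s (suc k))) (run-fits d s k)))) ⟩
      ∑ (directions (suc k)) (λ d → ∑ (upTo B) (λ s → 𝟙[ s + suc k ≤? B ] * F (run d s (suc k)))) ∎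
      where
      open ≡-Reasoning
      δ : List ℕ → Direction → ℕ → ℕ
      δ u d s = 𝟙[ u ≟ₗ run d s (suc k) ]

  take-length-++ : ∀ (u v : List ℕ) → take (length u) (u ++ v) ≡ u
  take-length-++ []      v = refl
  take-length-++ (x ∷ u) v = cong (x ∷_) (take-length-++ u v)

  drop-length-++ : ∀ (u v : List ℕ) → drop (length u) (u ++ v) ≡ v
  drop-length-++ []      v = refl
  drop-length-++ (x ∷ u) v = drop-length-++ u v

  blockwiseWalk : List ℕ → List ℕ → ℕ
  blockwiseWalk []      w = 1
  blockwiseWalk (k ∷ π) w = 𝟙[ walk? (take k w) ] * blockwiseWalk π (drop k w)

  orientations : List ℕ → ℕ
  orientations []      = 1
  orientations (k ∷ π) = length (directions k) * orientations π

  walkWords : ℕ → List ℕ → List ℕ → ℕ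
  walkWords B π P = ∑ (words B (sum π)) (λ w → 𝟙[ distinct? (P ++ w) ] * blockwiseWalk π w)

  module _ {B : ℕ} where

    walkWords-nonUnique : ∀ π {P} → ¬ Unique P → walkWords B π P ≡ 0
    walkWords-nonUnique π {P} ¬u = ∑-vanish (words B (sum π)) (λ w →
      cong (λ b → 𝟙 b * blockwiseWalk π w) (dec-false (distinct? (P ++ w)) (¬u ∘ Unique-++⁻ˡ P)))

    walkWords-resp-↭ : ∀ π {P P′} → P ↭ P′ → walkWords B π P ≡ walkWords B π P′
    walkWords-resp-↭ π p = ∑-cong (words B (sum π)) (λ w →
      cong (λ b → 𝟙 b * blockwiseWalk π w) (distinct?-resp-↭ (++⁺ʳ w p)))

    walkWords-cons : ∀ k π P →
      walkWords B (k ∷ π) P ≡ ∑ (words B k) (λ u → 𝟙[ walk? u ] * walkWords B π (P ++ u))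
    walkWords-cons k π P = begin
      ∑ (words B (k + sum π)) F
        ≡⟨ ∑-words-+ k (sum π) F ⟩
      ∑ (words B k) (λ u → ∑ (words B (sum π)) (λ v → F (u ++ v)))
        ≡⟨ ∑-cong-∈ (words B k) (λ {u} u∈ →
             ∑-cong (words B (sum π)) (λ v → split u v (proj₁ (∈-words⁻ k u∈)))) ⟩
      ∑ (words B k) (λ u → ∑ (words B (sum π)) (λ v →
        𝟙[ walk? u ] * (𝟙[ distinct? ((P ++ u) ++ v) ] * blockwiseWalk π v)))
        ≡⟨ ∑-cong (words B k) (λ u → sym (∑-distribˡ (words B (sum π)) 𝟙[ walk? u ] _)) ⟩
      ∑ (words B k) (λ u → 𝟙[ walk? u ] * walkWords B π (P ++ u)) ∎
      where
      open ≡-Reasoning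
      F = λ w → 𝟙[ distinct? (P ++ w) ] * blockwiseWalk (k ∷ π) w
      split : ∀ u v → length u ≡ k →
              F (u ++ v) ≡ 𝟙[ walk? u ] * (𝟙[ distinct? ((P ++ u) ++ v) ] * blockwiseWalk π v)
      split u v refl rewrite take-length-++ u v | drop-length-++ u v | ++-assoc P u v =
        x*[y*z]≡y*[x*z] 𝟙[ distinct? (P ++ u ++ v) ] 𝟙[ walk? u ] _

    walkWords-placements : ∀ π P → All (1 ≤_) π → walkWords B π P ≡ orientations π * placements B B π P
    walkWords-placements []      P _ = trans (+-identityʳ _) (trans (*-identityʳ _) (trans
      (cong (λ Q → 𝟙[ distinct? Q ]) (++-identityʳ P)) (sym (+-identityʳ _))))
    walkWords-placements (suc k ∷ π) P (_ ∷ pos) = begin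
      walkWords B (suc k ∷ π) P
        ≡⟨ walkWords-cons (suc k) π P ⟩
      ∑ (words B (suc k)) (λ u → 𝟙[ walk? u ] * G u)
        ≡⟨ ∑-cong (words B (suc k)) (λ u → only-distinct u) ⟩
      ∑ (words B (suc k)) (λ u → 𝟙 (does (walk? u) ∧ does (distinct? u)) * G u)
        ≡⟨ ∑-distinctWalks {B} k G ⟩
      ∑ (directions (suc k)) (λ d → ∑ (upTo B) (λ s → 𝟙[ s + suc k ≤? B ] * G (run d s (suc k))))
        ≡⟨ ∑-cong (directions (suc k)) (λ d → ∑-cong (upTo B) (λ s →
             cong (𝟙[ s + suc k ≤? B ] *_) (walkWords-resp-↭ π (++⁺ˡ P (run↭ascending d s (suc k)))))) ⟩
      ∑ (directions (suc k)) (λ _ → ∑ (upTo B) (λ s → 𝟙[ s + suc k ≤? B ] * G (ascending s (suc k))))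
        ≡⟨ ∑-const (directions (suc k)) _ ⟩
      length (directions (suc k)) * ∑ (upTo B) (λ s → 𝟙[ s + suc k ≤? B ] * G (ascending s (suc k)))
        ≡⟨ cong (length (directions (suc k)) *_) (begin
             ∑ (upTo B) (λ s → 𝟙[ s + suc k ≤? B ] * G (ascending s (suc k)))
               ≡⟨ ∑-cong (upTo B) (λ s → trans
                    (cong (𝟙[ s + suc k ≤? B ] *_) (walkWords-placements π (P ++ ascending s (suc k)) pos))
                    (x*[y*z]≡y*[x*z] 𝟙[ s + suc k ≤? B ] (orientations π) _)) ⟩
             ∑ (upTo B) (λ s →
               orientations π * (𝟙[ s + suc k ≤? B ] * placements B B π (P ++ ascending s (suc k))))
               ≡⟨ sym (∑-distribˡ (upTo B) (orientations π) _) ⟩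
             orientations π * placements B B (suc k ∷ π) P ∎) ⟩
      length (directions (suc k)) * (orientations π * placements B B (suc k ∷ π) P)
        ≡⟨ sym (*-assoc (length (directions (suc k))) _ _) ⟩
      orientations (suc k ∷ π) * placements B B (suc k ∷ π) P ∎
      where
      open ≡-Reasoning
      G = λ u → walkWords B π (P ++ u)
      only-distinct : ∀ u → 𝟙[ walk? u ] * G u ≡ 𝟙 (does (walk? u) ∧ does (distinct? u)) * G u
      only-distinct u with distinct? u
      ... | yes _  = cong (λ b → 𝟙 b * G u) (sym (∧-identityʳ (does (walk? u))))
      ... | no ¬u = trans (cong (𝟙[ walk? u ] *_) (walkWords-nonUnique π (¬u ∘ Unique-++⁻ʳ P)))
                          (trans (*-zeroʳ 𝟙[ walk? u ])
                                 (cong (λ b → 𝟙 b * G u) (sym (∧-zeroʳ (does (walk? u))))))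

  blockCovers : (B m k : ℕ) → List ℕ → ℕ
  blockCovers B m k w = ∑ (listsLen B m) (λ π → 𝟙[ sum π ≟ k ] * blockwiseWalk π w)

  private
    𝟙-+-≟ : ∀ a s k → 𝟙[ a + s ≟ k ] ≡ 𝟙[ a ≤? k ] * 𝟙[ s ≟ k ∸ a ]
    𝟙-+-≟ a s k with a ≤? k
    ... | no a≰k rewrite dec-false (a ≤? k) a≰k =
      cong 𝟙 (dec-false (a + s ≟ k) (λ a+s≡k → a≰k (subst (a ≤_) a+s≡k (m≤m+n a s))))
    ... | yes a≤k rewrite dec-true (a ≤? k) a≤k = trans (cong 𝟙 (does-⇔
      (mk⇔ (λ a+s≡k → trans (sym (m+n∸m≡n a s)) (cong (_∸ a) a+s≡k))
           (λ s≡k∸a → trans (cong (a +_) s≡k∸a) (m+[n∸m]≡n a≤k)))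
      (a + s ≟ k) (s ≟ k ∸ a))) (sym (+-identityʳ _))

  blockCovers-suc : ∀ B m k w → blockCovers B (suc m) k w ≡
    ∑ (upTo B) (λ x → 𝟙[ suc x ≤? k ] *
      (𝟙[ walk? (take (suc x) w) ] * blockCovers B m (k ∸ suc x) (drop (suc x) w)))
  blockCovers-suc B m k w = begin
    ∑ (concatMap (λ x → map (suc x ∷_) (listsLen B m)) (upTo B)) F
      ≡⟨ ∑-concatMap _ (upTo B) F ⟩
    ∑ (upTo B) (λ x → ∑ (map (suc x ∷_) (listsLen B m)) F)
      ≡⟨ ∑-cong (upTo B) (λ x → trans (∑-map (suc x ∷_) (listsLen B m) F)
           (∑-cong (listsLen B m) (first-part x))) ⟩
    ∑ (upTo B) (λ x → ∑ (listsLen B m) (λ π → c x * (W x * rest x π)))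
      ≡⟨ ∑-cong (upTo B) (λ x → trans (sym (∑-distribˡ (listsLen B m) (c x) _))
           (cong (c x *_) (sym (∑-distribˡ (listsLen B m) (W x) _)))) ⟩
    ∑ (upTo B) (λ x → c x * (W x * blockCovers B m (k ∸ suc x) (drop (suc x) w))) ∎
    where
    open ≡-Reasoning
    F = λ π → 𝟙[ sum π ≟ k ] * blockwiseWalk π w
    c = λ x → 𝟙[ suc x ≤? k ]
    W = λ x → 𝟙[ walk? (take (suc x) w) ]
    rest = λ x π → 𝟙[ sum π ≟ k ∸ suc x ] * blockwiseWalk π (drop (suc x) w)
    first-part : ∀ x π → F (suc x ∷ π) ≡ c x * (W x * rest x π)
    first-part x π = begin
      𝟙[ suc x + sum π ≟ k ] * (W x * blockwiseWalk π (drop (suc x) w))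
        ≡⟨ cong (_* _) (𝟙-+-≟ (suc x) (sum π) k) ⟩
      c x * 𝟙[ sum π ≟ k ∸ suc x ] * (W x * blockwiseWalk π (drop (suc x) w))
        ≡⟨ *-assoc (c x) _ _ ⟩
      c x * (𝟙[ sum π ≟ k ∸ suc x ] * (W x * blockwiseWalk π (drop (suc x) w)))
        ≡⟨ cong (c x *_) (x*[y*z]≡y*[x*z] 𝟙[ sum π ≟ k ∸ suc x ] (W x) _) ⟩
      c x * (W x * rest x π) ∎

  blockCovers-vanish : ∀ B m k w → k < m → blockCovers B m k w ≡ 0
  blockCovers-vanish B (suc m) k w k<1+m = trans (blockCovers-suc B m k w) (∑-vanish (upTo B) (λ x →
    trans (𝟙-*-cong (suc x ≤? k) (λ 1+x≤k → cong (W x *_)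
            (blockCovers-vanish B m (k ∸ suc x) (drop (suc x) w)
              (<-≤-trans (∸-monoʳ-< z<s 1+x≤k) (≤-pred k<1+m)))))
          (trans (cong (𝟙[ suc x ≤? k ] *_) (*-zeroʳ (W x))) (*-zeroʳ 𝟙[ suc x ≤? k ]))))
    where W = λ x → 𝟙[ walk? (take (suc x) w) ]

module Rationals where

  open import Algebra.Bundles using (CommutativeRing)
  open import Data.Bool using (true; false)
  import Data.Integer as ℤ
  import Data.Integer.Properties as ℤ
  open import Data.List using (List; []; _∷_)
  open import Data.Nat as ℕ using (ℕ; zero; suc; _∸_; _≤_)
  import Data.Nat.Coprimality as Coprimality
  import Data.Nat.Properties as ℕ
  open import Data.Rational using (ℚ; mkℚ; 1ℚ; _+_; _*_; -_; _/_)
  open import Data.Rational.Properties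
    using (+-*-commutativeRing; normalize-coprime; *-identityˡ; *-identityʳ; *-assoc)
  open import Data.Rational.Solver using (module +-*-Solver)
  open import Function using (id)
  open import Relation.Binary.PropositionalEquality

  open import Defs using (fromℕ; _^ℚ_)

  open +-*-Solver using (solve; _:*_; _:=_; :-_; con)

  module ℕ∑ = ListSum ℕ.+-*-commutativeSemiring id
  module ℚ∑ = ListSum (CommutativeRing.commutativeSemiring +-*-commutativeRing) id

  fromℕ≡mkℚ : ∀ a → fromℕ a ≡ mkℚ (ℤ.+ a) 0 (Coprimality.sym (Coprimality.1-coprimeTo a))
  fromℕ≡mkℚ a = normalize-coprime (Coprimality.sym (Coprimality.1-coprimeTo a))

  fromℕ-+ : ∀ a b → fromℕ (a ℕ.+ b) ≡ fromℕ a + fromℕ b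
  fromℕ-+ a b rewrite fromℕ≡mkℚ a | fromℕ≡mkℚ b =
    sym (cong₂ (λ x y → (x ℤ.+ y) / 1) (ℤ.*-identityʳ (ℤ.+ a)) (ℤ.*-identityʳ (ℤ.+ b)))

  fromℕ-* : ∀ a b → fromℕ (a ℕ.* b) ≡ fromℕ a * fromℕ b
  fromℕ-* a b rewrite fromℕ≡mkℚ a | fromℕ≡mkℚ b = cong (_/ 1) (ℤ.pos-* a b)

  fromℕ-∑ : ∀ {A : Set} (xs : List A) f → fromℕ (ℕ∑.∑ xs f) ≡ ℚ∑.∑ xs (λ x → fromℕ (f x))
  fromℕ-∑ []       f = refl
  fromℕ-∑ (x ∷ xs) f = trans (fromℕ-+ (f x) _) (cong (fromℕ (f x) +_) (fromℕ-∑ xs f))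

  fromℕ-𝟙 : ∀ b → fromℕ (ℕ∑.𝟙 b) ≡ ℚ∑.𝟙 b
  fromℕ-𝟙 true  = refl
  fromℕ-𝟙 false = refl

  sign : ℕ → ℚ
  sign m = (- 1ℚ) ^ℚ m

  sign-+ : ∀ a b → sign (a ℕ.+ b) ≡ sign a * sign b
  sign-+ zero    b = sym (*-identityˡ (sign b))
  sign-+ (suc a) b = trans (cong ((- 1ℚ) *_) (sign-+ a b)) (sym (*-assoc (- 1ℚ) (sign a) (sign b)))

  sign-involutive : ∀ a → sign a * sign a ≡ 1ℚ
  sign-involutive zero    = refl
  sign-involutive (suc a) =
    trans (solve 1 (λ s → ((:- con 1ℚ) :* s) :* ((:- con 1ℚ) :* s) := s :* s) refl (sign a)) (sign-involutive a)

  sign-∸ : ∀ {a} b → b ≤ a → sign (a ∸ b) ≡ sign a * sign b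
  sign-∸ {a} b b≤a = begin
    sign (a ∸ b)                         ≡⟨ sym (*-identityʳ _) ⟩
    sign (a ∸ b) * 1ℚ                    ≡⟨ cong (sign (a ∸ b) *_) (sym (sign-involutive b)) ⟩
    sign (a ∸ b) * (sign b * sign b)     ≡⟨ sym (*-assoc (sign (a ∸ b)) _ _) ⟩
    sign (a ∸ b) * sign b * sign b       ≡⟨ cong (_* sign b) (sym (sign-+ (a ∸ b) b)) ⟩
    sign (a ∸ b ℕ.+ b) * sign b          ≡⟨ cong (λ t → sign t * sign b) (ℕ.m∸n+n≡m b≤a) ⟩
    sign a * sign b                      ∎
    where open ≡-Reasoning

module InclusionExclusion where

  open import Data.Bool using (true; false; not)
  open import Data.List using (List; []; _∷_; upTo; length; take; drop)
  open import Data.List.Membership.Propositional.Properties using (∈-upTo⁻)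
  open import Data.List.Properties using (length-drop)
  open import Data.List.Relation.Unary.Linked using (Linked; linked?)
  open import Data.Nat as ℕ using (ℕ; zero; suc; _∸_; _≤_; _<_; _≤?_; _<?_; z<s; s≤s)
  open import Data.Nat.Induction using (<-rec)
  import Data.Nat.Properties as ℕ
  open import Data.Rational using (ℚ; 0ℚ; 1ℚ; _+_; _*_; -_)
  import Data.Rational.Properties as ℚ
  open import Data.Rational.Properties using (*-assoc)
  open import Data.Rational.Solver using (module +-*-Solver)
  open import Function using (_∘_)
  open import Relation.Binary.PropositionalEquality
  import Relation.Unary as U
  open import Relation.Nullary using (¬_; does)
  open import Relation.Nullary.Decidable using (¬?)

  open import Defs using (fromℕ)
  open Runs using (Adjacent; adjacent?; walk?)
  open WalkWords using (blockCovers; blockCovers-suc; blockCovers-vanish)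
  open Rationals
  open ℚ∑

  open +-*-Solver using (solve; _:*_; _:+_; _:=_; :-_; con)
  open ≡-Reasoning

  Apart : List ℕ → Set
  Apart = Linked (λ x y → ¬ Adjacent x y)

  apart? : U.Decidable Apart
  apart? = linked? (λ x y → ¬? (adjacent? x y))

  private
    1-𝟙 : ∀ c N → 1ℚ * (1ℚ * N) + ((- 1ℚ) * 𝟙 c) * N ≡ 𝟙 (not c) * N
    1-𝟙 true  N =
      solve 1 (λ N → con 1ℚ :* (con 1ℚ :* N) :+ ((:- con 1ℚ) :* con 1ℚ) :* N := con 0ℚ :* N) refl N
    1-𝟙 false N =
      solve 1 (λ N → con 1ℚ :* (con 1ℚ :* N) :+ ((:- con 1ℚ) :* con 0ℚ) :* N := con 1ℚ :* N) refl N

  apartTerm : ℕ → List ℕ → ℕ → ℚ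
  apartTerm a w x = sign x * (𝟙[ walk? (take (suc x) (a ∷ w)) ] * 𝟙[ apart? (drop (suc x) (a ∷ w)) ])

  apart-expansion : ∀ a w → ∑ (upTo (suc (length w))) (apartTerm a w) ≡ 𝟙[ apart? (a ∷ w) ]
  apart-expansion a []      = refl
  apart-expansion a (b ∷ w) = begin
    ∑ (upTo (suc (suc (length w)))) (apartTerm a (b ∷ w))
      ≡⟨ ∑-upTo-suc (suc (length w)) (apartTerm a (b ∷ w)) ⟩
    1ℚ * (1ℚ * N) + ∑ (upTo (suc (length w))) (apartTerm a (b ∷ w) ∘ suc)
      ≡⟨ cong (1ℚ * (1ℚ * N) +_) (trans (∑-cong (upTo (suc (length w))) through-b)
                                         (sym (∑-distribˡ (upTo (suc (length w))) ((- 1ℚ) * A) _))) ⟩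
    1ℚ * (1ℚ * N) + ((- 1ℚ) * A) * ∑ (upTo (suc (length w))) (apartTerm b w)
      ≡⟨ cong (λ t → 1ℚ * (1ℚ * N) + ((- 1ℚ) * A) * t) (apart-expansion b w) ⟩
    1ℚ * (1ℚ * N) + ((- 1ℚ) * A) * N
      ≡⟨ 1-𝟙 (does (adjacent? a b)) N ⟩
    𝟙 (not (does (adjacent? a b))) * N
      ≡⟨ sym (𝟙-∧ (not (does (adjacent? a b))) _) ⟩
    𝟙[ apart? (a ∷ b ∷ w) ] ∎
    where
    A = 𝟙[ adjacent? a b ]
    N = 𝟙[ apart? (b ∷ w) ]
    through-b : ∀ y → apartTerm a (b ∷ w) (suc y) ≡ ((- 1ℚ) * A) * apartTerm b w y
    through-b y = begin
      (- 1ℚ) * sign y * (𝟙[ walk? (a ∷ take (suc y) (b ∷ w)) ] * Ny)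
        ≡⟨ cong (λ t → (- 1ℚ) * sign y * (t * Ny)) (𝟙-∧ (does (adjacent? a b)) _) ⟩
      (- 1ℚ) * sign y * ((A * Wy) * Ny)
        ≡⟨ solve 4 (λ s A W N → ((:- con 1ℚ) :* s) :* ((A :* W) :* N) := ((:- con 1ℚ) :* A) :* (s :* (W :* N)))
                   refl (sign y) A Wy Ny ⟩
      ((- 1ℚ) * A) * apartTerm b w y ∎
      where
      Wy = 𝟙[ walk? (take (suc y) (b ∷ w)) ]
      Ny = 𝟙[ apart? (drop (suc y) (b ∷ w)) ]

  signedCovers : ℕ → ℕ → List ℕ → ℚ
  signedCovers B k w = ∑ (upTo (suc B)) (λ m → sign m * fromℕ (blockCovers B m k w))

  firstBlock : ℕ → List ℕ → ℕ → ℚ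
  firstBlock k w x = 𝟙[ suc x ≤? k ] * 𝟙[ walk? (take (suc x) w) ]

  fromℕ-blockCovers-suc : ∀ B m k w → fromℕ (blockCovers B (suc m) k w) ≡
    ∑ (upTo B) (λ x → firstBlock k w x * fromℕ (blockCovers B m (k ∸ suc x) (drop (suc x) w)))
  fromℕ-blockCovers-suc B m k w = trans (cong fromℕ (blockCovers-suc B m k w))
    (trans (fromℕ-∑ (upTo B) block) (∑-cong (upTo B) fromℕ-block))
    where
    block : ℕ → ℕ
    block x = ℕ∑.𝟙[ suc x ≤? k ] ℕ.* (ℕ∑.𝟙[ walk? (take (suc x) w) ] ℕ.* rest x)
      where rest = λ x → blockCovers B m (k ∸ suc x) (drop (suc x) w)
    fromℕ-block : ∀ x → fromℕ (block x) ≡ firstBlock k w x * fromℕ (blockCovers B m (k ∸ suc x) (drop (suc x) w))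
    fromℕ-block x = trans
      (trans (fromℕ-* ℕ∑.𝟙[ suc x ≤? k ] _) (cong₂ _*_ (fromℕ-𝟙 (does (suc x ≤? k)))
        (trans (fromℕ-* ℕ∑.𝟙[ walk? (take (suc x) w) ] _) (cong (_* F) (fromℕ-𝟙 (does (walk? (take (suc x) w))))))))
      (sym (*-assoc 𝟙[ suc x ≤? k ] _ F))
      where F = fromℕ (blockCovers B m (k ∸ suc x) (drop (suc x) w))

  signedCovers-truncate : ∀ B j w → j < B →
    signedCovers B j w ≡ ∑ (upTo B) (λ m → sign m * fromℕ (blockCovers B m j w))
  signedCovers-truncate B j w j<B = begin
    ∑ (upTo (suc B)) S           ≡⟨ ∑-upTo-∷ʳ B S ⟩
    ∑ (upTo B) S + S B
      ≡⟨ cong (λ t → ∑ (upTo B) S + sign B * fromℕ t) (blockCovers-vanish B B j w j<B) ⟩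
    ∑ (upTo B) S + sign B * 0ℚ   ≡⟨ cong (∑ (upTo B) S +_) (ℚ.*-zeroʳ (sign B)) ⟩
    ∑ (upTo B) S + 0ℚ            ≡⟨ ℚ.+-identityʳ _ ⟩
    ∑ (upTo B) S                 ∎
    where S = λ m → sign m * fromℕ (blockCovers B m j w)

  signedCovers-suc : ∀ B k w → suc k ≤ B →
    signedCovers B (suc k) w
      ≡ (- 1ℚ) * ∑ (upTo B) (λ x → firstBlock (suc k) w x * signedCovers B (k ∸ x) (drop (suc x) w))
  signedCovers-suc B k w 1+k≤B = begin
    ∑ (upTo (suc B)) (λ m → sign m * fromℕ (blockCovers B m (suc k) w))
      ≡⟨ ∑-upTo-suc B (λ m → sign m * fromℕ (blockCovers B m (suc k) w)) ⟩
    1ℚ * 0ℚ + ∑ (upTo B) (λ m → sign (suc m) * fromℕ (blockCovers B (suc m) (suc k) w))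
      ≡⟨ trans (ℚ.+-identityˡ _)
               (∑-cong (upTo B) (λ m → cong (sign (suc m) *_) (fromℕ-blockCovers-suc B m (suc k) w))) ⟩
    ∑ (upTo B) (λ m → (- 1ℚ) * sign m * ∑ (upTo B) (λ x → c x * F m x))
      ≡⟨ ∑-cong (upTo B) (λ m → trans (*-assoc (- 1ℚ) (sign m) _) (cong ((- 1ℚ) *_)
           (trans (∑-distribˡ (upTo B) (sign m) (λ x → c x * F m x))
                  (∑-cong (upTo B) (λ x → x*[y*z]≡y*[x*z] (sign m) (c x) (F m x)))))) ⟩
    ∑ (upTo B) (λ m → (- 1ℚ) * ∑ (upTo B) (λ x → c x * (sign m * F m x)))
      ≡⟨ sym (∑-distribˡ (upTo B) (- 1ℚ) (λ m → ∑ (upTo B) (λ x → c x * (sign m * F m x)))) ⟩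
    (- 1ℚ) * ∑ (upTo B) (λ m → ∑ (upTo B) (λ x → c x * (sign m * F m x)))
      ≡⟨ cong ((- 1ℚ) *_) (trans (∑-swap (upTo B) (upTo B) (λ m x → c x * (sign m * F m x)))
                                 (∑-cong (upTo B) (λ x → sym (∑-distribˡ (upTo B) (c x) (λ m → sign m * F m x))))) ⟩
    (- 1ℚ) * ∑ (upTo B) (λ x → c x * ∑ (upTo B) (λ m → sign m * F m x))
      ≡⟨ cong ((- 1ℚ) *_) (∑-cong (upTo B) (λ x → cong (c x *_)
           (sym (signedCovers-truncate B (k ∸ x) (drop (suc x) w) (ℕ.≤-<-trans (ℕ.m∸n≤m k x) 1+k≤B))))) ⟩
    (- 1ℚ) * ∑ (upTo B) (λ x → c x * signedCovers B (k ∸ x) (drop (suc x) w)) ∎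
    where
    c = firstBlock (suc k) w
    F = λ m x → fromℕ (blockCovers B m (k ∸ x) (drop (suc x) w))

  signedCovers-apart : ∀ B k w → length w ≡ k → k ≤ B → signedCovers B k w ≡ sign k * 𝟙[ apart? w ]
  signedCovers-apart B = <-rec Holds step
    where
    Holds : ℕ → Set
    Holds k = ∀ w → length w ≡ k → k ≤ B → signedCovers B k w ≡ sign k * 𝟙[ apart? w ]
    step : ∀ k → (∀ {j} → j < k → Holds j) → Holds k
    step zero rec [] _ _ = begin
      ∑ (upTo (suc B)) (λ m → sign m * fromℕ (blockCovers B m 0 []))
        ≡⟨ ∑-upTo-suc B (λ m → sign m * fromℕ (blockCovers B m 0 [])) ⟩
      1ℚ * 1ℚ + ∑ (upTo B) (λ m → sign (suc m) * fromℕ (blockCovers B (suc m) 0 []))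
        ≡⟨ cong (1ℚ * 1ℚ +_) (∑-vanish (upTo B) (λ m → trans
             (cong (λ t → sign (suc m) * fromℕ t) (blockCovers-vanish B (suc m) 0 [] z<s))
             (ℚ.*-zeroʳ (sign (suc m))))) ⟩
      1ℚ * 1ℚ + 0ℚ
        ≡⟨ ℚ.+-identityʳ _ ⟩
      1ℚ * 1ℚ ∎
    step (suc k) rec (a ∷ w) |w| 1+k≤B = begin
      signedCovers B (suc k) (a ∷ w)
        ≡⟨ signedCovers-suc B k (a ∷ w) 1+k≤B ⟩
      (- 1ℚ) * ∑ (upTo B) (λ x → firstBlock (suc k) (a ∷ w) x * signedCovers B (k ∸ x) (drop (suc x) (a ∷ w)))
        ≡⟨ cong ((- 1ℚ) *_) (∑-cong (upTo B) (λ x → trans (*-assoc 𝟙[ x <? suc k ] (W x) _)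
             (𝟙-*-cong (x <? suc k) (λ _ → cong (W x *_) (rest x))))) ⟩
      (- 1ℚ) * ∑ (upTo B) (λ x → 𝟙[ x <? suc k ] * (W x * (sign (k ∸ x) * N x)))
        ≡⟨ cong ((- 1ℚ) *_) (∑-upTo-restrict (λ x → W x * (sign (k ∸ x) * N x)) 1+k≤B) ⟩
      (- 1ℚ) * ∑ (upTo (suc k)) (λ x → W x * (sign (k ∸ x) * N x))
        ≡⟨ cong ((- 1ℚ) *_) (trans
             (∑-cong-∈ (upTo (suc k)) (λ {x} x∈ → separate-sign x (ℕ.≤-pred (∈-upTo⁻ x∈))))
             (sym (∑-distribˡ (upTo (suc k)) (sign k) (apartTerm a w)))) ⟩
      (- 1ℚ) * (sign k * ∑ (upTo (suc k)) (apartTerm a w))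
        ≡⟨ cong (λ l → (- 1ℚ) * (sign k * ∑ (upTo (suc l)) (apartTerm a w))) (sym (ℕ.suc-injective |w|)) ⟩
      (- 1ℚ) * (sign k * ∑ (upTo (suc (length w))) (apartTerm a w))
        ≡⟨ cong (λ t → (- 1ℚ) * (sign k * t)) (apart-expansion a w) ⟩
      (- 1ℚ) * (sign k * 𝟙[ apart? (a ∷ w) ])
        ≡⟨ sym (*-assoc (- 1ℚ) (sign k) _) ⟩
      sign (suc k) * 𝟙[ apart? (a ∷ w) ] ∎
      where
      W = λ x → 𝟙[ walk? (take (suc x) (a ∷ w)) ]
      N = λ x → 𝟙[ apart? (drop (suc x) (a ∷ w)) ]
      rest : ∀ x → signedCovers B (k ∸ x) (drop (suc x) (a ∷ w)) ≡ sign (k ∸ x) * N x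
      rest x = rec (s≤s (ℕ.m∸n≤m k x)) (drop (suc x) (a ∷ w))
                   (trans (length-drop (suc x) (a ∷ w)) (cong (_∸ x) (ℕ.suc-injective |w|)))
                   (ℕ.≤-trans (ℕ.m∸n≤m k x) (ℕ.<⇒≤ 1+k≤B))
      separate-sign : ∀ x → x ≤ k → W x * (sign (k ∸ x) * N x) ≡ sign k * apartTerm a w x
      separate-sign x x≤k rewrite sign-∸ x x≤k =
        solve 4 (λ W s t N → W :* ((s :* t) :* N) := s :* (t :* (W :* N))) refl (W x) (sign k) (sign x) (N x)

  𝟙-apart≡signedCovers : ∀ n w → length w ≡ n → 𝟙[ apart? w ] ≡ sign n * signedCovers n n w
  𝟙-apart≡signedCovers n w |w| = begin
    𝟙[ apart? w ]                          ≡⟨ sym (ℚ.*-identityˡ _) ⟩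
    1ℚ * 𝟙[ apart? w ]                     ≡⟨ cong (_* 𝟙[ apart? w ]) (sym (sign-involutive n)) ⟩
    sign n * sign n * 𝟙[ apart? w ]        ≡⟨ *-assoc (sign n) (sign n) _ ⟩
    sign n * (sign n * 𝟙[ apart? w ])      ≡⟨ cong (sign n *_) (sym (signedCovers-apart n n w |w| ℕ.≤-refl)) ⟩
    sign n * signedCovers n n w            ∎

module Mutable where

  open import Data.Bool using (Bool; true; false; not; _∧_; _∨_; T)
  open import Data.Bool.ListAction using (and)
  open import Data.Bool.Properties using (∧-zeroʳ; ∨-zeroʳ; T-≡; ¬-not)
  open import Data.Empty using (⊥)
  open import Data.Fin using (Fin; toℕ; fromℕ<)
  open import Data.List as List using (List; []; _∷_; map; upTo; length; concatMap; allFin; filterᵇ)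
  open import Data.List.Membership.Propositional using (_∈_)
  open import Data.List.Membership.Propositional.Properties using (∈-upTo⁺)
  open import Data.List.Properties using (map-cong; map-tabulate)
  open import Data.List.Relation.Unary.All as All using (All; []; _∷_)
  open import Data.List.Relation.Unary.All.Properties using (all⁺; all⁻)
  open import Data.List.Relation.Unary.Any using (here; there)
  open import Data.List.Relation.Unary.Linked using ([]; [-]; _∷_)
  open import Data.List.Relation.Unary.Unique.Propositional using (Unique)
  open import Data.List.Relation.Unary.AllPairs using (_∷_)
  open import Data.Nat using (ℕ; zero; suc; _+_; _≤_; _<_; _≡ᵇ_; _<ᵇ_; _≟_; _<?_; z≤n; s≤s)
  open import Data.Nat.Properties using (≡ᵇ⇒≡; ≤-pred; <-trans; <-irrefl; n<1+n; m<n⇒m<1+n; ≮⇒≥; 1+n≢n)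
  open import Data.Product using (∃; ∃₂; _×_; _,_)
  open import Data.Sum using (inj₁; inj₂)
  open import Data.Vec as Vec using (Vec; []; _∷_; lookup)
  open import Function using (id; _∘_; Equivalence)
  open import Relation.Binary.PropositionalEquality
  open import Relation.Nullary using (¬_; does; yes; no; contradiction)
  open import Relation.Nullary.Decidable using (dec-true)

  open import Defs
  open Distinct using (distinct?; distinctᵇ≡does)
  open Runs using (Adjacent; adjacent?)
  open Words using (words; ∑-words-suc; ∈-words⁻)
  open InclusionExclusion using (Apart; apart?)
  open Rationals using (module ℕ∑)

  open ℕ∑

  word : ∀ {n k} → Vec (Fin n) k → List ℕ
  word v = map toℕ (Vec.toList v)

  length-word : ∀ {n k} (v : Vec (Fin n) k) → length (word v) ≡ k
  length-word []      = refl
  length-word (x ∷ v) = cong suc (length-word v)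

  length-filterᵇ : ∀ {A : Set} (p : A → Bool) xs → length (filterᵇ p xs) ≡ ∑ xs (λ x → 𝟙 (p x))
  length-filterᵇ p []       = refl
  length-filterᵇ p (x ∷ xs) with p x
  ... | true  = cong suc (length-filterᵇ p xs)
  ... | false = length-filterᵇ p xs

  ∑-allVecs : ∀ n k (G : List ℕ → ℕ) → ∑ (allVecs n k) (G ∘ word) ≡ ∑ (words n k) G
  ∑-allVecs n zero    G = refl
  ∑-allVecs n (suc k) G = begin
    ∑ (concatMap (λ x → map (x ∷_) (allVecs n k)) (allFin n)) (G ∘ word)
      ≡⟨ ∑-concatMap _ (allFin n) _ ⟩
    ∑ (allFin n) (λ x → ∑ (map (x ∷_) (allVecs n k)) (G ∘ word))
      ≡⟨ ∑-cong (allFin n) (λ x →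
           trans (∑-map (x ∷_) (allVecs n k) _) (∑-allVecs n k (λ u → G (toℕ x ∷ u)))) ⟩
    ∑ (allFin n) (λ x → ∑ (words n k) (λ u → G (toℕ x ∷ u)))
      ≡⟨ sym (∑-map toℕ (allFin n) (λ y → ∑ (words n k) (λ u → G (y ∷ u)))) ⟩
    ∑ (map toℕ (allFin n)) (λ y → ∑ (words n k) (λ u → G (y ∷ u)))
      ≡⟨ cong (λ l → ∑ l (λ y → ∑ (words n k) (λ u → G (y ∷ u))))
              (trans (map-tabulate id toℕ) (tabulate-toℕ n id)) ⟩
    ∑ (upTo n) (λ y → ∑ (words n k) (λ u → G (y ∷ u)))
      ≡⟨ sym (∑-words-suc {n} k G) ⟩
    ∑ (words n (suc k)) G ∎
    where
    open ≡-Reasoning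
    tabulate-toℕ : ∀ m (f : ℕ → ℕ) → List.tabulate (f ∘ toℕ {m}) ≡ List.applyUpTo f m
    tabulate-toℕ zero    f = refl
    tabulate-toℕ (suc m) f = cong (f 0 ∷_) (tabulate-toℕ m (f ∘ suc))

  hasOne : List ℕ → ℕ → ℕ → Bool
  hasOne []      i       j = false
  hasOne (x ∷ w) zero    j = x ≡ᵇ j
  hasOne (x ∷ w) (suc i) j = hasOne w i j

  entry≡hasOne : ∀ {n} (v : Vec (Fin n) n) i j → entry v i j ≡ hasOne (word v) i j
  entry≡hasOne {n} v i j with i <? n
  ... | yes i<n = inside v i i<n
    where
    inside : ∀ {m} (u : Vec (Fin n) m) i .(i<m : i < m) →
             (toℕ (lookup u (fromℕ< i<m)) ≡ᵇ j) ≡ hasOne (word u) i j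
    inside (x ∷ u) zero    _   = refl
    inside (x ∷ u) (suc i) i<m = inside u i (≤-pred i<m)
  ... | no i≮n = sym (outside (word v) i (subst (_≤ i) (sym (length-word v)) (≮⇒≥ i≮n)))
    where
    outside : ∀ w i → length w ≤ i → hasOne w i j ≡ false
    outside []      i       _         = refl
    outside (x ∷ w) (suc i) (s≤s |w|≤i) = outside w i |w|≤i

  above : List ℕ → ℕ → ℕ → Bool
  above w zero    j = false
  above w (suc i) j = hasOne w i j

  left : List ℕ → ℕ → ℕ → Bool
  left w i zero    = false
  left w i (suc j) = hasOne w i j

  mutableCell : List ℕ → ℕ → ℕ → Bool
  mutableCell w i j = not (hasOne w i j) ∧
    (1 <ᵇ (b2n (above w i j) + b2n (hasOne w (suc i) j) + b2n (left w i j) + b2n (hasOne w i (suc j))))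

  mutableᵇ≡mutableCell : ∀ {n} (v : Vec (Fin n) n) i j → mutableᵇ v i j ≡ mutableCell (word v) i j
  mutableᵇ≡mutableCell v zero zero
    rewrite entry≡hasOne v 0 0 | entry≡hasOne v 1 0 | entry≡hasOne v 0 1 = refl
  mutableᵇ≡mutableCell v zero (suc j)
    rewrite entry≡hasOne v 0 (suc j) | entry≡hasOne v 1 (suc j)
          | entry≡hasOne v 0 j | entry≡hasOne v 0 (suc (suc j)) = refl
  mutableᵇ≡mutableCell v (suc i) zero
    rewrite entry≡hasOne v (suc i) 0 | entry≡hasOne v i 0
          | entry≡hasOne v (suc (suc i)) 0 | entry≡hasOne v (suc i) 1 = refl
  mutableᵇ≡mutableCell v (suc i) (suc j)
    rewrite entry≡hasOne v (suc i) (suc j) | entry≡hasOne v i (suc j) | entry≡hasOne v (suc (suc i)) (suc j)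
          | entry≡hasOne v (suc i) j | entry≡hasOne v (suc i) (suc (suc j)) = refl

  private
    ∧-false : ∀ {x y} → (x ≡ true → y ≡ true → ⊥) → x ∧ y ≡ false
    ∧-false {true}  {true}  f = contradiction refl (f refl)
    ∧-false {true}  {false} f = refl
    ∧-false {false}         f = refl

    ≡ᵇ-true⇒≡ : ∀ x y → (x ≡ᵇ y) ≡ true → x ≡ y
    ≡ᵇ-true⇒≡ x y e = ≡ᵇ⇒≡ x y (Equivalence.from T-≡ e)

  hasOne⇒< : ∀ w i {j} → hasOne w i j ≡ true → i < length w
  hasOne⇒< (x ∷ w) zero    _ = s≤s z≤n
  hasOne⇒< (x ∷ w) (suc i) e = s≤s (hasOne⇒< w i e)

  hasOne⇒∈ : ∀ w i {j} → hasOne w i j ≡ true → j ∈ w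
  hasOne⇒∈ (x ∷ w) zero    e = here (sym (≡ᵇ-true⇒≡ x _ e))
  hasOne⇒∈ (x ∷ w) (suc i) e = there (hasOne⇒∈ w i e)

  hasOne-functional : ∀ w i {x y} → hasOne w i x ≡ true → hasOne w i y ≡ true → x ≡ y
  hasOne-functional (a ∷ w) zero    e₁ e₂ = trans (sym (≡ᵇ-true⇒≡ a _ e₁)) (≡ᵇ-true⇒≡ a _ e₂)
  hasOne-functional (a ∷ w) (suc i) e₁ e₂ = hasOne-functional w i e₁ e₂

  hasOne-elsewhere : ∀ w i {x y} → hasOne w i x ≡ true → x ≢ y → hasOne w i y ≡ false
  hasOne-elsewhere w i {x} {y} e x≢y with hasOne w i y in e′
  ... | true  = contradiction (hasOne-functional w i e e′) x≢y
  ... | false = refl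

  Unique⇒columnOnce : ∀ {w} → Unique w → ∀ i {j} → hasOne w i j ≡ true → hasOne w (suc (suc i)) j ≡ true → ⊥
  Unique⇒columnOnce {a ∷ w} (a∉ ∷ _)     zero    e₁ e₂ =
    All.lookup a∉ (hasOne⇒∈ w 1 e₂) (≡ᵇ-true⇒≡ a _ e₁)
  Unique⇒columnOnce {a ∷ w} (_ ∷ unique) (suc i) e₁ e₂ = Unique⇒columnOnce unique i e₁ e₂

  Apart⇒rowsApart : ∀ {w} → Apart w → ∀ i {x y} →
                    hasOne w i x ≡ true → hasOne w (suc i) y ≡ true → ¬ Adjacent x y
  Apart⇒rowsApart {a ∷ b ∷ w} (¬ab ∷ _)   zero    e₁ e₂ =
    subst₂ (λ x y → ¬ Adjacent x y) (≡ᵇ-true⇒≡ a _ e₁) (≡ᵇ-true⇒≡ b _ e₂) ¬ab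
  Apart⇒rowsApart {a ∷ b ∷ w} (_ ∷ apart) (suc i) e₁ e₂ = Apart⇒rowsApart apart i e₁ e₂

  ¬Apart⇒adjacentRows : ∀ x w → ¬ Apart (x ∷ w) →
    ∃ λ i → ∃₂ λ a b → hasOne (x ∷ w) i a ≡ true × hasOne (x ∷ w) (suc i) b ≡ true × Adjacent a b
  ¬Apart⇒adjacentRows x []      ¬apart = contradiction [-] ¬apart
  ¬Apart⇒adjacentRows x (y ∷ w) ¬apart with adjacent? x y
  ... | yes adj  = 0 , x , y , dec-true (x ≟ x) refl , dec-true (y ≟ y) refl , adj
  ... | no ¬adj with i , rows ← ¬Apart⇒adjacentRows y w (¬apart ∘ (¬adj ∷_)) = suc i , rows

  private
    atMostOne : ∀ a b c d → a ∧ b ≡ false → a ∧ c ≡ false → a ∧ d ≡ false →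
                            b ∧ c ≡ false → b ∧ d ≡ false → c ∧ d ≡ false →
                (1 <ᵇ (b2n a + b2n b + b2n c + b2n d)) ≡ false
    atMostOne true  true  _     _     () _  _  _  _  _
    atMostOne true  false true  _     _  () _  _  _  _
    atMostOne true  false false true  _  _  () _  _  _
    atMostOne true  false false false _  _  _  _  _  _ = refl
    atMostOne false true  true  _     _  _  _  () _  _
    atMostOne false true  false true  _  _  _  _  () _
    atMostOne false true  false false _  _  _  _  _  _ = refl
    atMostOne false false true  true  _  _  _  _  _  ()
    atMostOne false false true  false _  _  _  _  _  _ = refl
    atMostOne false false false true  _  _  _  _  _  _ = refl
    atMostOne false false false false _  _  _  _  _  _ = refl

    atLeastTwo : ∀ a c d → c ∨ d ≡ true → (1 <ᵇ (b2n a + 1 + b2n c + b2n d)) ≡ true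
    atLeastTwo false true  _    _ = refl
    atLeastTwo false false true _ = refl
    atLeastTwo true  true  _    _ = refl
    atLeastTwo true  false true _ = refl

  -- A zero cell has at most one neighbouring 1: two vertical ones would repeat a column, two
  -- horizontal ones would put two 1s in a row, and a vertical and a horizontal one would be 1s in
  -- consecutive rows and adjacent columns.
  module _ {w} (apart : Apart w) (unique : Unique w) where

    private
      rowsApart : ∀ i {x y} → Adjacent x y → hasOne w i x ∧ hasOne w (suc i) y ≡ false
      rowsApart i x~y = ∧-false (λ e₁ e₂ → Apart⇒rowsApart apart i e₁ e₂ x~y)

      rowsApart′ : ∀ i {x y} → Adjacent x y → hasOne w (suc i) y ∧ hasOne w i x ≡ false
      rowsApart′ i x~y = ∧-false (λ e₂ e₁ → Apart⇒rowsApart apart i e₁ e₂ x~y)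

    Apart⇒¬mutableCell : ∀ i j → mutableCell w i j ≡ false
    Apart⇒¬mutableCell i j = trans
      (cong (not (hasOne w i j) ∧_) (atMostOne (above w i j) (hasOne w (suc i) j) (left w i j) (hasOne w i (suc j))
        (north-south i) (north-west i j) (north-east i) (south-west j) (rowsApart′ i (inj₂ refl)) (west-east j)))
      (∧-zeroʳ _)
      where
      north-south : ∀ i → above w i j ∧ hasOne w (suc i) j ≡ false
      north-south zero    = refl
      north-south (suc i) = ∧-false (Unique⇒columnOnce unique i)
      north-west : ∀ i j → above w i j ∧ left w i j ≡ false
      north-west zero    j       = refl
      north-west (suc i) zero    = ∧-zeroʳ _
      north-west (suc i) (suc j) = rowsApart i (inj₂ refl)
      north-east : ∀ i → above w i j ∧ hasOne w i (suc j) ≡ false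
      north-east zero    = refl
      north-east (suc i) = rowsApart i (inj₁ refl)
      south-west : ∀ j → hasOne w (suc i) j ∧ left w i j ≡ false
      south-west zero    = ∧-zeroʳ _
      south-west (suc j) = rowsApart′ i (inj₁ refl)
      west-east : ∀ j → left w i j ∧ hasOne w i (suc j) ≡ false
      west-east zero    = refl
      west-east (suc j) = ∧-false (λ e₁ e₂ → <-irrefl (hasOne-functional w i e₁ e₂) (m<n⇒m<1+n (n<1+n j)))

  adjacentRows⇒mutableCell : ∀ w i {x y} → hasOne w i x ≡ true → hasOne w (suc i) y ≡ true → Adjacent x y →
                              mutableCell w i y ≡ true
  adjacentRows⇒mutableCell w i {x} e₁ e₂ (inj₁ refl)
    rewrite hasOne-elsewhere w i e₁ (1+n≢n ∘ sym) | e₂ | e₁ = atLeastTwo (above w i (suc x)) true _ refl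
  adjacentRows⇒mutableCell w i {y = y} e₁ e₂ (inj₂ refl)
    rewrite hasOne-elsewhere w i e₁ 1+n≢n | e₂ | e₁ = atLeastTwo (above w i y) (left w i y) true (∨-zeroʳ _)

  noMutableCells : ℕ → List ℕ → Bool
  noMutableCells n w = allᵇ (λ i → allᵇ (λ j → not (mutableCell w i j)) (upTo n)) (upTo n)

  noMutableᵇ≡noMutableCells : ∀ {n} (v : Vec (Fin n) n) → noMutableᵇ v ≡ noMutableCells n (word v)
  noMutableᵇ≡noMutableCells {n} v = cong and (map-cong (λ i →
    cong and (map-cong (λ j → cong not (mutableᵇ≡mutableCell v i j)) (upTo n))) (upTo n))

  ¬Apart⇒mutableCell : ∀ {n w} → length w ≡ n → All (_< n) w → ¬ Apart w → ¬ T (noMutableCells n w)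
  ¬Apart⇒mutableCell {w = []}    _   _   ¬apart = contradiction [] ¬apart
  ¬Apart⇒mutableCell {n} {x ∷ r} |w| w<n ¬apart t
    with i , a , b , e₁ , e₂ , a~b ← ¬Apart⇒adjacentRows x r ¬apart =
    subst (T ∘ not) (adjacentRows⇒mutableCell (x ∷ r) i e₁ e₂ a~b)
                    (All.lookup (all⁺ _ _ (All.lookup (all⁺ _ _ t) i∈)) b∈)
    where
    i∈ : i ∈ upTo n
    i∈ = ∈-upTo⁺ (subst (i <_) |w| (<-trans (n<1+n i) (hasOne⇒< (x ∷ r) (suc i) e₂)))
    b∈ : b ∈ upTo n
    b∈ = ∈-upTo⁺ (All.lookup w<n (hasOne⇒∈ (x ∷ r) (suc i) e₂))

  noMutableCells≡apart : ∀ {n w} → Unique w → length w ≡ n → All (_< n) w →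
                         noMutableCells n w ≡ does (apart? w)
  noMutableCells≡apart {n} {w} unique |w| w<n with apart? w
  ... | no ¬apart = ¬-not (¬Apart⇒mutableCell |w| w<n ¬apart ∘ Equivalence.from T-≡)
  ... | yes apart = Equivalence.to T-≡ (all⁻ _ (All.universal (λ i → all⁻ _ (All.universal (λ j →
    subst (T ∘ not) (sym (Apart⇒¬mutableCell apart unique i j)) _) (upTo n))) (upTo n)))

  a≡∑-distinct-apart : ∀ n → a n ≡ ∑ (words n n) (λ w → 𝟙 (does (distinct? w) ∧ does (apart? w)))
  a≡∑-distinct-apart n = begin
    length (filterᵇ (λ v → isPermᵇ v ∧ noMutableᵇ v) (allVecs n n))
      ≡⟨ length-filterᵇ _ (allVecs n n) ⟩
    ∑ (allVecs n n) (λ v → 𝟙 (isPermᵇ v ∧ noMutableᵇ v))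
      ≡⟨ ∑-cong (allVecs n n) (λ v → cong (λ b → 𝟙 (isPermᵇ v ∧ b)) (noMutableᵇ≡noMutableCells v)) ⟩
    ∑ (allVecs n n) (G ∘ word)
      ≡⟨ ∑-allVecs n n G ⟩
    ∑ (words n n) G
      ≡⟨ ∑-cong-∈ (words n n) (λ {w} w∈ → let |w| , w<n = ∈-words⁻ n w∈ in permutation w |w| w<n) ⟩
    ∑ (words n n) (λ w → 𝟙 (does (distinct? w) ∧ does (apart? w))) ∎
    where
    open ≡-Reasoning
    G = λ w → 𝟙 (distinctᵇ w ∧ noMutableCells n w)
    permutation : ∀ w → length w ≡ n → All (_< n) w → G w ≡ 𝟙 (does (distinct? w) ∧ does (apart? w))
    permutation w |w| w<n rewrite distinctᵇ≡does w with distinct? w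
    ... | yes unique = cong 𝟙 (noMutableCells≡apart unique |w| w<n)
    ... | no _       = refl

module Compositions where

  open import Data.List using (List; []; _∷_; upTo; length)
  open import Data.List.Membership.Propositional using (_∈_; find)
  open import Data.List.Membership.Propositional.Properties using (∈-filter⁻; ∈-concatMap⁻; ∈-map⁻)
  open import Data.List.Relation.Unary.All using (All; []; _∷_)
  open import Data.List.Relation.Unary.Any using (here)
  open import Data.Nat using (zero; suc; _*_; _≤_; _≡ᵇ_; _≟_; _!; z≤n; s≤s)
  open import Data.Nat.ListAction using (sum)
  open import Data.Nat.Properties using (+-*-commutativeSemiring; ≤-refl)
  open import Data.Product using (_×_; _,_; proj₁)
  open import Function using (id)
  open import Relation.Binary.PropositionalEquality
  open import Relation.Nullary using (T?)

  open import Defs using (listsLen; C)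
  open Distinct using (distinct?)
  open Words using (words)
  open Count using (arrangements-diag)
  open Placements using (placements; placements-count)
  open WalkWords using (blockwiseWalk; orientations; walkWords-placements; blockCovers)

  open ListSum +-*-commutativeSemiring id
  open ≡-Reasoning

  ∈-listsLen⁻ : ∀ B m {π} → π ∈ listsLen B m → length π ≡ m × All (1 ≤_) π
  ∈-listsLen⁻ B zero    (here refl) = refl , []
  ∈-listsLen⁻ B (suc m) π∈
    with x , _ , ρ∈ ← find (∈-concatMap⁻ _ {xs = upTo B} π∈) with ρ , ρ∈ , refl ← ∈-map⁻ _ ρ∈ =
    let |ρ| , pos = ∈-listsLen⁻ B m ρ∈ in cong suc |ρ| , s≤s z≤n ∷ pos

  ∈-C⁻ : ∀ n m {π} → π ∈ C n m → length π ≡ m × All (1 ≤_) π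
  ∈-C⁻ n m π∈ = ∈-listsLen⁻ n m (proj₁ (∈-filter⁻ (λ π → T? (sum π ≡ᵇ n)) π∈))

  distinctWords-blockCovers : ∀ n m →
    ∑ (words n n) (λ w → 𝟙[ distinct? w ] * blockCovers n m n w)
      ≡ ∑ (C n m) (λ π → orientations π * m !)
  distinctWords-blockCovers n m = begin
    ∑ (words n n) (λ w → D w * ∑ (listsLen n m) (λ π → S π * blockwiseWalk π w))
      ≡⟨ ∑-cong (words n n) (λ w → ∑-distribˡ (listsLen n m) (D w) _) ⟩
    ∑ (words n n) (λ w → ∑ (listsLen n m) (λ π → D w * (S π * blockwiseWalk π w)))
      ≡⟨ ∑-swap (words n n) (listsLen n m) _ ⟩
    ∑ (listsLen n m) (λ π → ∑ (words n n) (λ w → D w * (S π * blockwiseWalk π w)))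
      ≡⟨ ∑-cong (listsLen n m) (λ π → trans
           (∑-cong (words n n) (λ w → x*[y*z]≡y*[x*z] (D w) (S π) _))
           (sym (∑-distribˡ (words n n) (S π) _))) ⟩
    ∑ (listsLen n m) (λ π → S π * ∑ (words n n) (λ w → D w * blockwiseWalk π w))
      ≡⟨ ∑-cong-∈ (listsLen n m) (λ {π} π∈ →
           𝟙-*-cong (sum π ≟ n) (λ sum≡n → composition π sum≡n (∈-listsLen⁻ n m π∈))) ⟩
    ∑ (listsLen n m) (λ π → S π * (orientations π * m !))
      ≡⟨ sym (∑-filterᵇ (λ π → sum π ≡ᵇ n) (listsLen n m) _) ⟩
    ∑ (C n m) (λ π → orientations π * m !) ∎
    where
    D = λ w → 𝟙[ distinct? w ]
    S = λ π → 𝟙[ sum π ≟ n ]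
    composition : ∀ π → sum π ≡ n → length π ≡ m × All (1 ≤_) π →
                  ∑ (words n n) (λ w → D w * blockwiseWalk π w) ≡ orientations π * m !
    composition π refl (refl , pos) = begin
      ∑ (words (sum π) (sum π)) (λ w → D w * blockwiseWalk π w)
        ≡⟨ walkWords-placements π [] pos ⟩
      orientations π * placements (sum π) (sum π) π []
        ≡⟨ cong (orientations π *_)
                (trans (placements-count (sum π) π ≤-refl pos) (arrangements-diag (sum π) (length π))) ⟩
      orientations π * length π ! ∎

open import Data.Bool using (_∧_)
open import Data.List using (List; []; _∷_; upTo; length; concatMap)
open import Data.List.Relation.Unary.All using (All; []; _∷_)
open import Data.Nat as ℕ using (ℕ; zero; suc; _≤_; _!)
import Data.Nat.Properties as ℕ
open import Data.Product using (_×_; _,_; proj₁)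
open import Data.Rational using (ℚ; 0ℚ; 1ℚ; ½; _+_; _*_; -_)
import Data.Rational.Properties as ℚ
open import Data.Rational.Solver using (module +-*-Solver)
open import Relation.Binary.PropositionalEquality
open import Relation.Nullary using (does)

open import Defs
open Distinct using (distinct?)
open Words using (words; ∈-words⁻)
open WalkWords using (orientations; blockCovers)
open Compositions using (∈-C⁻; distinctWords-blockCovers)
open InclusionExclusion using (apart?; signedCovers; 𝟙-apart≡signedCovers)
open Mutable using (a≡∑-distinct-apart)
open Rationals
open ℚ∑

open +-*-Solver using (solve; _:*_; _:=_; :-_; con)
open ≡-Reasoning

two : ℚ
two = fromℕ 2

fromℕ-orientations : ∀ π → All (1 ≤_) π → fromℕ (orientations π) ≡ two ^ℚ length π * inv2^ (ones π)
fromℕ-orientations []          []        = refl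
fromℕ-orientations (1 ∷ π)     (_ ∷ pos) = begin
  fromℕ (orientations π ℕ.+ 0)         ≡⟨ cong fromℕ (ℕ.+-identityʳ (orientations π)) ⟩
  fromℕ (orientations π)               ≡⟨ fromℕ-orientations π pos ⟩
  P * H                                ≡⟨ solve 2 (λ P H → P :* H := (con two :* P) :* (con ½ :* H)) refl P H ⟩
  (two * P) * (½ * H)                  ∎
  where
  P = two ^ℚ length π
  H = inv2^ (ones π)
fromℕ-orientations (suc (suc k) ∷ π) (_ ∷ pos) = begin
  fromℕ (2 ℕ.* orientations π)         ≡⟨ fromℕ-* 2 (orientations π) ⟩
  two * fromℕ (orientations π)         ≡⟨ cong (two *_) (fromℕ-orientations π pos) ⟩
  two * (two ^ℚ length π * H)          ≡⟨ sym (ℚ.*-assoc two (two ^ℚ length π) H) ⟩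
  two * two ^ℚ length π * H            ∎
  where H = inv2^ (ones π)

-two^≡sign*two^ : ∀ m → (- two) ^ℚ m ≡ sign m * two ^ℚ m
-two^≡sign*two^ zero    = refl
-two^≡sign*two^ (suc m) = trans (cong ((- two) *_) (-two^≡sign*two^ m))
  (solve 2 (λ s p → (:- con two) :* (s :* p) := ((:- con 1ℚ) :* s) :* (con two :* p)) refl (sign m) (two ^ℚ m))

signed-term : ∀ n m → sign m * fromℕ (ℕ∑.∑ (C n m) (λ π → orientations π ℕ.* m !))
                      ≡ fromℕ (m !) * ((- two) ^ℚ m) * Σℚ (C n m) (λ π → inv2^ (ones π))
signed-term n m = begin
  sign m * fromℕ (ℕ∑.∑ (C n m) (λ π → orientations π ℕ.* m !))
    ≡⟨ cong (sign m *_) (trans (fromℕ-∑ (C n m) _)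
                               (∑-cong-∈ (C n m) (λ {π} π∈ → weight π (∈-C⁻ n m π∈)))) ⟩
  sign m * ∑ (C n m) (λ π → (two ^ℚ m * fromℕ (m !)) * inv2^ (ones π))
    ≡⟨ cong (sign m *_) (sym (∑-distribˡ (C n m) (two ^ℚ m * fromℕ (m !)) _)) ⟩
  sign m * ((two ^ℚ m * fromℕ (m !)) * Σ)
    ≡⟨ solve 4 (λ s p f x → s :* ((p :* f) :* x) := (f :* (s :* p)) :* x)
               refl (sign m) (two ^ℚ m) (fromℕ (m !)) Σ ⟩
  fromℕ (m !) * (sign m * two ^ℚ m) * Σ
    ≡⟨ cong (λ t → fromℕ (m !) * t * Σ) (sym (-two^≡sign*two^ m)) ⟩
  fromℕ (m !) * ((- two) ^ℚ m) * Σ ∎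
  where
  Σ = Σℚ (C n m) (λ π → inv2^ (ones π))
  weight : ∀ π → length π ≡ m × All (1 ≤_) π →
           fromℕ (orientations π ℕ.* m !) ≡ (two ^ℚ m * fromℕ (m !)) * inv2^ (ones π)
  weight π (refl , pos) = begin
    fromℕ (orientations π ℕ.* length π !)
      ≡⟨ fromℕ-* (orientations π) _ ⟩
    fromℕ (orientations π) * fromℕ (length π !)
      ≡⟨ cong (_* fromℕ (length π !)) (fromℕ-orientations π pos) ⟩
    (two ^ℚ length π * inv2^ (ones π)) * fromℕ (length π !)
      ≡⟨ solve 3 (λ p h f → (p :* h) :* f := (p :* f) :* h) refl
                 (two ^ℚ length π) (inv2^ (ones π)) (fromℕ (length π !)) ⟩
    (two ^ℚ length π * fromℕ (length π !)) * inv2^ (ones π) ∎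

fromℕ-distinctWords-blockCovers : ∀ n m →
  ∑ (words n n) (λ w → 𝟙[ distinct? w ] * fromℕ (blockCovers n m n w))
    ≡ fromℕ (ℕ∑.∑ (C n m) (λ π → orientations π ℕ.* m !))
fromℕ-distinctWords-blockCovers n m = begin
  ∑ (words n n) (λ w → 𝟙[ distinct? w ] * fromℕ (blockCovers n m n w))
    ≡⟨ ∑-cong (words n n) (λ w → trans
         (cong (_* fromℕ (blockCovers n m n w)) (sym (fromℕ-𝟙 (does (distinct? w)))))
         (sym (fromℕ-* ℕ∑.𝟙[ distinct? w ] (blockCovers n m n w)))) ⟩
  ∑ (words n n) (λ w → fromℕ (ℕ∑.𝟙[ distinct? w ] ℕ.* blockCovers n m n w))
    ≡⟨ sym (fromℕ-∑ (words n n) (λ w → ℕ∑.𝟙[ distinct? w ] ℕ.* blockCovers n m n w)) ⟩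
  fromℕ (ℕ∑.∑ (words n n) (λ w → ℕ∑.𝟙[ distinct? w ] ℕ.* blockCovers n m n w))
    ≡⟨ cong fromℕ (distinctWords-blockCovers n m) ⟩
  fromℕ (ℕ∑.∑ (C n m) (λ π → orientations π ℕ.* m !)) ∎

a-signed : ∀ n →
  fromℕ (a n) ≡ sign n * ∑ (upTo (suc n)) (λ m → sign m * fromℕ (ℕ∑.∑ (C n m) (λ π → orientations π ℕ.* m !)))
a-signed n = begin
  fromℕ (a n)
    ≡⟨ cong fromℕ (a≡∑-distinct-apart n) ⟩
  fromℕ (ℕ∑.∑ (words n n) (λ w → ℕ∑.𝟙 (does (distinct? w) ∧ does (apart? w))))
    ≡⟨ trans (fromℕ-∑ (words n n) _) (∑-cong (words n n) (λ w →
         trans (fromℕ-𝟙 (does (distinct? w) ∧ does (apart? w))) (𝟙-∧ (does (distinct? w)) _))) ⟩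
  ∑ (words n n) (λ w → 𝟙[ distinct? w ] * 𝟙[ apart? w ])
    ≡⟨ ∑-cong-∈ (words n n) (λ {w} w∈ → trans
         (cong (𝟙[ distinct? w ] *_) (𝟙-apart≡signedCovers n w (proj₁ (∈-words⁻ n w∈))))
         (x*[y*z]≡y*[x*z] 𝟙[ distinct? w ] (sign n) _)) ⟩
  ∑ (words n n) (λ w → sign n * (𝟙[ distinct? w ] * signedCovers n n w))
    ≡⟨ sym (∑-distribˡ (words n n) (sign n) _) ⟩
  sign n * ∑ (words n n) (λ w → 𝟙[ distinct? w ] * ∑ (upTo (suc n)) (λ m → sign m * F m w))
    ≡⟨ cong (sign n *_) (trans
         (∑-cong (words n n) (λ w → trans (∑-distribˡ (upTo (suc n)) 𝟙[ distinct? w ] _)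
           (∑-cong (upTo (suc n)) (λ m → x*[y*z]≡y*[x*z] 𝟙[ distinct? w ] (sign m) (F m w)))))
         (∑-swap (words n n) (upTo (suc n)) (λ w m → sign m * (𝟙[ distinct? w ] * F m w)))) ⟩
  sign n * ∑ (upTo (suc n)) (λ m → ∑ (words n n) (λ w → sign m * (𝟙[ distinct? w ] * F m w)))
    ≡⟨ cong (sign n *_) (∑-cong (upTo (suc n)) (λ m →
         trans (sym (∑-distribˡ (words n n) (sign m) _)) (cong (sign m *_) (fromℕ-distinctWords-blockCovers n m)))) ⟩
  sign n * ∑ (upTo (suc n)) (λ m → sign m * fromℕ (ℕ∑.∑ (C n m) (λ π → orientations π ℕ.* m !))) ∎
  where
  F = λ m w → fromℕ (blockCovers n m n w)

theorem6p1 : (n : ℕ) → 1 ≤ n →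
    (fromℕ (a n) ≡ ((- 1ℚ) ^ℚ n) * Σℚ (oneTo n) (λ m → fromℕ (m !) * ((- (fromℕ 2)) ^ℚ m) * Σℚ (C n m) (λ π → inv2^ (ones π))))
    × (fromℕ (a n) ≡ ((- 1ℚ) ^ℚ n) * Σℚ (Cₙ n) (λ π → fromℕ (length π !) * ((- (fromℕ 2)) ^ℚ length π) * inv2^ (ones π)))
theorem6p1 (suc n) _ = by-parts , trans by-parts (cong (sign (suc n) *_) (sym by-compositions))
  where
  -- upTo (suc k) unfolds to 0 ∷ oneTo k, and the m = 0 terms are 0ℚ because C (suc n) 0 is empty.
  T = λ m → fromℕ (m !) * ((- two) ^ℚ m) * Σℚ (C (suc n) m) (λ π → inv2^ (ones π))
  by-parts : fromℕ (a (suc n)) ≡ sign (suc n) * Σℚ (oneTo (suc n)) T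
  by-parts = trans (a-signed (suc n))
    (cong (sign (suc n) *_) (trans (ℚ.+-identityˡ _) (∑-cong (oneTo (suc n)) (signed-term (suc n)))))
  f = λ π → fromℕ (length π !) * ((- two) ^ℚ length π) * inv2^ (ones π)
  by-compositions : Σℚ (Cₙ (suc n)) f ≡ Σℚ (oneTo (suc n)) T
  by-compositions = begin
    ∑ (concatMap (C (suc n)) (upTo (suc (suc n)))) f
      ≡⟨ ∑-concatMap (C (suc n)) (upTo (suc (suc n))) f ⟩
    0ℚ + ∑ (oneTo (suc n)) (λ m → ∑ (C (suc n) m) f)
      ≡⟨ trans (ℚ.+-identityˡ _) (∑-cong (oneTo (suc n)) (λ m → trans
           (∑-cong-∈ (C (suc n) m) (λ {π} π∈ →
              cong (λ l → fromℕ (l !) * ((- two) ^ℚ l) * inv2^ (ones π)) (proj₁ (∈-C⁻ (suc n) m π∈))))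
           (sym (∑-distribˡ (C (suc n) m) (fromℕ (m !) * ((- two) ^ℚ m)) (λ π → inv2^ (ones π)))))) ⟩
    ∑ (oneTo (suc n)) T ∎
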